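{- Let $m$ and $n$ be non-negative integers and let $j$, $r$, $s$ be any integers. Then \[ \sum_{k = 0}^n (-1)^k\binom nk F_{j(2rk + s)}^{2m + 1} = \begin{cases} (-1)^n 5^{ -m} \sum_{i = 0}^m (-1)^{i(js + 1)} \binom{2m + 1}{i} L_{(2m + 1 - 2i)jr}^n F_{(2m + 1 - 2i)(jrn + js)}, & jr \text{ odd},\\ 5^{n/2 - m} \sum_{i = 0}^m (-1)^{i(js + 1)} \binom{2m + 1}{i} F_{(2m + 1 - 2i)jr}^n F_{(2m + 1 - 2i)(jrn + js)}, & jr \text{ even},\ n \text{ even},\\ -5^{(n - 1)/2 - m} \sum_{i = 0}^m (-1)^{i(js + 1)} \binom{2m + 1}{i} F_{(2m + 1 - 2i)jr}^n L_{(2m + 1 - 2i)(jrn + js)}, & jr \text{ even},\ n \text{ odd}, \end{cases} \] and \[ \sum_{k = 0}^n (-1)^k\binom nk L_{j(2rk + s)}^{2m + 1} = \begin{cases} (-1)^n \sum_{i = 0}^m (-1)^{ijs} \binom{2m + 1}{i} L_{(2m + 1 - 2i)jr}^n L_{(2m + 1 - 2i)(jrn + js)}, & jr \text{ odd},\\ 5^{n/2} \sum_{i = 0}^m (-1)^{ijs} \binom{2m + 1}{i} F_{(2m + 1 - 2i)jr}^n L_{(2m + 1 - 2i)(jrn + js)}, & jr \text{ even},\ n \text{ even},\\ -5^{(n + 1)/2} \sum_{i = 0}^m (-1)^{ijs} \binom{2m + 1}{i} F_{(2m + 1 - 2i)jr}^n F_{(2m + 1 - 2i)(jrn + js)}, &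 jr \text{ even},\ n \text{ odd}. \end{cases} \]
   Context: The Fibonacci numbers $F_n$ and Lucas numbers $L_n$ are defined for all integers $n$ by $F_0=0$, $F_1=1$, $L_0=2$, $L_1=1$, $F_n=F_{n-1}+F_{n-2}$, $L_n=L_{n-1}+L_{n-2}$, extended to negative indices by $F_{ -n}=(-1)^{n-1}F_n$, $L_{ -n}=(-1)^nL_n$. The convention $0^0=1$ is used. -}

module Defs where

open import Data.Nat as ℕ using (ℕ; zero; suc)
open import Data.Nat.DivMod using (_%_)
open import Data.Integer as ℤ using (ℤ; +_; -[1+_]; -_; _+_; _*_; _^_)

fibℕ : ℕ → ℕ
fibℕ zero = 0
fibℕ (suc zero) = 1
fibℕ (suc (suc n)) = fibℕ (suc n) ℕ.+ fibℕ n

lucℕ : ℕ → ℕ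
lucℕ zero = 2
lucℕ (suc zero) = 1
lucℕ (suc (suc n)) = lucℕ (suc n) ℕ.+ lucℕ n

neg1^ℕ : ℕ → ℤ
neg1^ℕ zero = + 1
neg1^ℕ (suc n) = - neg1^ℕ n

-- (-1)^z for z : ℤ  (well defined since (-1)^(-n) = (-1)^n)
neg1^ : ℤ → ℤ
neg1^ z = neg1^ℕ (ℤ.∣ z ∣ % 2)

-- F_n and L_n for all integers n, with F_{-n} = (-1)^(n-1) F_n, L_{-n} = (-1)^n L_n
F : ℤ → ℤ
F (+ n) = + fibℕ n
F (-[1+ n ]) = neg1^ℕ n * + fibℕ (suc n)

L : ℤ → ℤ
L (+ n) = + lucℕ n
L (-[1+ n ]) = neg1^ℕ (suc n) * + lucℕ (suc n)

sumTo : ℕ → (ℕ → ℤ) → ℤ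
sumTo zero f = f 0
sumTo (suc n) f = sumTo n f + f (suc n)

module Submission where

open import Algebra.Bundles using (CommutativeRing)
open import Algebra.Structures using (IsCommutativeRing)
open import Data.Empty using (⊥-elim)
open import Data.Integer as ℤ using (ℤ; 0ℤ; 1ℤ; -1ℤ; -[1+_])
import Data.Integer.Properties as ℤP
import Data.Integer.Tactic.RingSolver as ℤ-Solver
open import Data.Maybe using (nothing)
open import Data.Nat as ℕ using (ℕ; zero; suc; _∸_; _<_; _≤_; s≤s)
import Data.Nat.Properties as ℕP
import Data.Nat.Tactic.RingSolver as ℕ-Solver
open import Data.Nat.Combinatorics using (_C_; nCk≡nC[n∸k])
open import Data.Nat.DivMod using (_%_; _/_; m%n<n; m≡m%n+[m/n]*n; m*n/n≡m; [m+n]%n≡m%n)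
open import Data.Nat.Divisibility using (_∣_; m%n≡0⇒n∣m; n∣m⇒m%n≡0)
open import Data.Product using (_×_; _,_; proj₁)
open import Function using (_∘_)
open import Level using (0ℓ)
open import Relation.Binary.PropositionalEquality
open import Relation.Nullary using (¬_)
open import Tactic.RingSolver using (solve-∀)
import Tactic.RingSolver.Core.AlmostCommutativeRing as ACR
open import Defs

-- Work in ℤ[φ] with φ² = φ + 1 and conjugate ψ = 1 - φ. Since φ and ψ are units, Binet's
-- formulas √5 F_z = φ^z - ψ^z and L_z = φ^z + ψ^z hold for every integer z, so both sums are
-- alternating binomial sums of (φ^x + δψ^x)^(2m+1) with x = j(2rk + s) and δ = ∓1.
-- Pairing the binomial terms i and 2m + 1 - i gives
--   (φ^x + δψ^x)^(2m+1) = Σ_i C(2m+1,i) (δ(-1)^x)^i (φ^(cx) + δψ^(cx)),   c = 2m + 1 - 2i,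
-- and for u ∈ {φ, ψ} the alternating sum over k of u^(c j(2rk+s)) is u^(cjs) (1 - u^(2t))^n with
-- t = cjr. Finally 1 - φ^(2t) = -φ^t G and 1 - ψ^(2t) = (-1)^t ψ^t G with G = φ^t - (-1)^t ψ^t,
-- which is L_t for odd t and √5 F_t for even t; the parities of jr and n give the six cases.

module ℤ[φ] where

  open import Data.Integer using (_+_; _*_; -_)

  -- (a , b) stands for a + bφ, where φ² = φ + 1.
  ℤφ : Set
  ℤφ = ℤ × ℤ

  infixl 6 _⊕_
  infixl 7 _⊗_
  infix 8 ⊖_

  _⊕_ : ℤφ → ℤφ → ℤφ
  (a , b) ⊕ (c , d) = (a + c , b + d)

  _⊗_ : ℤφ → ℤφ → ℤφ
  (a , b) ⊗ (c , d) = (a * c + b * d , a * d + b * c + b * d)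

  ⊖_ : ℤφ → ℤφ
  ⊖ (a , b) = (- a , - b)

  0# 1# : ℤφ
  0# = (0ℤ , 0ℤ)
  1# = (1ℤ , 0ℤ)

  private
    ⊕-assoc : ∀ x y z → (x ⊕ y) ⊕ z ≡ x ⊕ (y ⊕ z)
    ⊕-assoc (a , b) (c , d) (e , f) = cong₂ _,_ (ℤP.+-assoc a c e) (ℤP.+-assoc b d f)

    ⊕-comm : ∀ x y → x ⊕ y ≡ y ⊕ x
    ⊕-comm (a , b) (c , d) = cong₂ _,_ (ℤP.+-comm a c) (ℤP.+-comm b d)

    ⊕-identityˡ : ∀ x → 0# ⊕ x ≡ x
    ⊕-identityˡ (a , b) = cong₂ _,_ (ℤP.+-identityˡ a) (ℤP.+-identityˡ b)

    ⊕-identityʳ : ∀ x → x ⊕ 0# ≡ x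
    ⊕-identityʳ (a , b) = cong₂ _,_ (ℤP.+-identityʳ a) (ℤP.+-identityʳ b)

    ⊖-inverseˡ : ∀ x → ⊖ x ⊕ x ≡ 0#
    ⊖-inverseˡ (a , b) = cong₂ _,_ (ℤP.+-inverseˡ a) (ℤP.+-inverseˡ b)

    ⊖-inverseʳ : ∀ x → x ⊕ ⊖ x ≡ 0#
    ⊖-inverseʳ (a , b) = cong₂ _,_ (ℤP.+-inverseʳ a) (ℤP.+-inverseʳ b)

    ⊗-assoc : ∀ x y z → (x ⊗ y) ⊗ z ≡ x ⊗ (y ⊗ z)
    ⊗-assoc (a , b) (c , d) (e , f) = cong₂ _,_ (constant-part a b c d e f) (φ-part a b c d e f)
      where
      constant-part : ∀ a b c d e f →
        (a * c + b * d) * e + (a * d + b * c + b * d) * f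
          ≡ a * (c * e + d * f) + b * (c * f + d * e + d * f)
      constant-part = ℤ-Solver.solve-∀
      φ-part : ∀ a b c d e f →
        (a * c + b * d) * f + (a * d + b * c + b * d) * e + (a * d + b * c + b * d) * f
          ≡ a * (c * f + d * e + d * f) + b * (c * e + d * f) + b * (c * f + d * e + d * f)
      φ-part = ℤ-Solver.solve-∀

    ⊗-comm : ∀ x y → x ⊗ y ≡ y ⊗ x
    ⊗-comm (a , b) (c , d) = cong₂ _,_ (constant-part a b c d) (φ-part a b c d)
      where
      constant-part : ∀ a b c d → a * c + b * d ≡ c * a + d * b
      constant-part = ℤ-Solver.solve-∀
      φ-part : ∀ a b c d → a * d + b * c + b * d ≡ c * b + d * a + d * b
      φ-part = ℤ-Solver.solve-∀

    ⊗-identityˡ : ∀ x → 1# ⊗ x ≡ x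
    ⊗-identityˡ (a , b) = cong₂ _,_ (constant-part a b) (φ-part a b)
      where
      constant-part : ∀ a b → 1ℤ * a + 0ℤ * b ≡ a
      constant-part = ℤ-Solver.solve-∀
      φ-part : ∀ a b → 1ℤ * b + 0ℤ * a + 0ℤ * b ≡ b
      φ-part = ℤ-Solver.solve-∀

    ⊗-identityʳ : ∀ x → x ⊗ 1# ≡ x
    ⊗-identityʳ x = trans (⊗-comm x 1#) (⊗-identityˡ x)

    ⊗-distribˡ-⊕ : ∀ x y z → x ⊗ (y ⊕ z) ≡ x ⊗ y ⊕ x ⊗ z
    ⊗-distribˡ-⊕ (a , b) (c , d) (e , f) = cong₂ _,_ (constant-part a b c d e f) (φ-part a b c d e f)
      where
      constant-part : ∀ a b c d e f → a * (c + e) + b * (d + f) ≡ (a * c + b * d) + (a * e + b * f)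
      constant-part = ℤ-Solver.solve-∀
      φ-part : ∀ a b c d e f →
        a * (d + f) + b * (c + e) + b * (d + f) ≡ (a * d + b * c + b * d) + (a * f + b * e + b * f)
      φ-part = ℤ-Solver.solve-∀

    ⊗-distribʳ-⊕ : ∀ x y z → (y ⊕ z) ⊗ x ≡ y ⊗ x ⊕ z ⊗ x
    ⊗-distribʳ-⊕ x y z =
      trans (⊗-comm (y ⊕ z) x) (trans (⊗-distribˡ-⊕ x y z) (cong₂ _⊕_ (⊗-comm x y) (⊗-comm x z)))

    isCommutativeRing : IsCommutativeRing _≡_ _⊕_ _⊗_ ⊖_ 0# 1#
    isCommutativeRing = record
      { isRing = record
        { +-isAbelianGroup = record
          { isGroup = record
            { isMonoid = record
              { isSemigroup = record
                { isMagma = record { isEquivalence = isEquivalence ; ∙-cong = cong₂ _⊕_ }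
                ; assoc = ⊕-assoc
                }
              ; identity = ⊕-identityˡ , ⊕-identityʳ
              }
            ; inverse = ⊖-inverseˡ , ⊖-inverseʳ
            ; ⁻¹-cong = cong ⊖_
            }
          ; comm = ⊕-comm
          }
        ; *-cong = cong₂ _⊗_
        ; *-assoc = ⊗-assoc
        ; *-identity = ⊗-identityˡ , ⊗-identityʳ
        ; distrib = ⊗-distribˡ-⊕ , ⊗-distribʳ-⊕
        }
      ; *-comm = ⊗-comm
      }

  commutativeRing : CommutativeRing 0ℓ 0ℓ
  commutativeRing = record { isCommutativeRing = isCommutativeRing }

  ℤφ-ring : ACR.AlmostCommutativeRing 0ℓ 0ℓ
  ℤφ-ring = ACR.fromCommutativeRing commutativeRing (λ _ → nothing)

module Binet where

  open ℤ[φ] renaming (_⊕_ to _+_; _⊗_ to _*_; ⊖_ to -_)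
  open CommutativeRing commutativeRing
    using (+-assoc; +-comm; +-identityˡ; +-identityʳ; *-assoc; *-comm; *-identityˡ; *-identityʳ;
           distribˡ; distribʳ; zeroˡ; zeroʳ; commutativeSemiring; semiring)
  open import Algebra.Properties.Ring (CommutativeRing.ring commutativeRing) using (-1*x≈-x)
  open import Algebra.Properties.CommutativeSemiring.Exp commutativeSemiring
    using (_^_; ^-homo-*; ^-assocʳ; ^-distrib-*)
  import Algebra.Properties.CommutativeSemiring.Binomial commutativeSemiring as Binomial
  open import Algebra.Properties.Semiring.Mult semiring renaming (_×_ to _×ᵣ_) using ()
  open import Algebra.Properties.Semiring.Sum semiring using (sum)
  open import Data.Fin using (toℕ)

  ι : ℤ → ℤφ
  ι a = (a , 0ℤ)

  ι-* : ∀ a b → ι (a ℤ.* b) ≡ ι a * ι b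
  ι-* a b = cong₂ _,_ (constant-part a b) (φ-part a b)
    where
    constant-part : ∀ a b → a ℤ.* b ≡ a ℤ.* b ℤ.+ 0ℤ ℤ.* 0ℤ
    constant-part = ℤ-Solver.solve-∀
    φ-part : ∀ a b → 0ℤ ≡ a ℤ.* 0ℤ ℤ.+ 0ℤ ℤ.* b ℤ.+ 0ℤ ℤ.* 0ℤ
    φ-part = ℤ-Solver.solve-∀

  ι-^ : ∀ a n → ι (a ℤ.^ n) ≡ ι a ^ n
  ι-^ a zero = refl
  ι-^ a (suc n) = trans (ι-* a (a ℤ.^ n)) (cong (ι a *_) (ι-^ a n))

  ι-injective : ∀ {a b} → ι a ≡ ι b → a ≡ b
  ι-injective = cong proj₁

  ι-neg1^ℕ : ∀ k → ι (neg1^ℕ k) ≡ (- 1#) ^ k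
  ι-neg1^ℕ zero = refl
  ι-neg1^ℕ (suc k) = trans (cong -_ (ι-neg1^ℕ k)) (sym (-1*x≈-x _))

  1^n≡1 : ∀ n → 1# ^ n ≡ 1#
  1^n≡1 zero = refl
  1^n≡1 (suc n) = trans (*-identityˡ _) (1^n≡1 n)

  -x^n≡[-1]^n*x^n : ∀ x n → (- x) ^ n ≡ (- 1#) ^ n * x ^ n
  -x^n≡[-1]^n*x^n x n = trans (cong (_^ n) (sym (-1*x≈-x x))) (^-distrib-* (- 1#) x n)

  x²≡1⇒x^odd≡x : ∀ {x} → x * x ≡ 1# → ∀ d → x ^ (2 ℕ.* d ℕ.+ 1) ≡ x
  x²≡1⇒x^odd≡x {x} x²≡1 d = begin
    x ^ (2 ℕ.* d ℕ.+ 1)      ≡⟨ ^-homo-* x (2 ℕ.* d) 1 ⟩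
    x ^ (2 ℕ.* d) * x ^ 1    ≡⟨ cong₂ _*_ (sym (^-assocʳ x 2 d)) (*-identityʳ x) ⟩
    (x ^ 2) ^ d * x          ≡⟨ cong (λ t → t ^ d * x) (trans (cong (x *_) (*-identityʳ x)) x²≡1) ⟩
    1# ^ d * x               ≡⟨ trans (cong (_* x) (1^n≡1 d)) (*-identityˡ x) ⟩
    x                        ∎
    where open ≡-Reasoning

  ∑ : ℕ → (ℕ → ℤφ) → ℤφ
  ∑ zero f = 0#
  ∑ (suc n) f = f 0 + ∑ n (f ∘ suc)

  ∑-cong : ∀ n {f g : ℕ → ℤφ} → (∀ i → i < n → f i ≡ g i) → ∑ n f ≡ ∑ n g
  ∑-cong zero eq = refl
  ∑-cong (suc n) eq = cong₂ _+_ (eq 0 (s≤s ℕ.z≤n)) (∑-cong n (λ i i<n → eq (suc i) (s≤s i<n)))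

  ∑-cong′ : ∀ n {f g : ℕ → ℤφ} → (∀ i → f i ≡ g i) → ∑ n f ≡ ∑ n g
  ∑-cong′ n eq = ∑-cong n (λ i _ → eq i)

  ∑-distrib-+ : ∀ n (f g : ℕ → ℤφ) → ∑ n (λ i → f i + g i) ≡ ∑ n f + ∑ n g
  ∑-distrib-+ zero f g = refl
  ∑-distrib-+ (suc n) f g =
    trans (cong (f 0 + g 0 +_) (∑-distrib-+ n (f ∘ suc) (g ∘ suc))) (shuffle (f 0) (g 0) _ _)
    where
    shuffle : ∀ a b c d → (a + b) + (c + d) ≡ (a + c) + (b + d)
    shuffle = solve-∀ ℤφ-ring

  *-distribˡ-∑ : ∀ n x (f : ℕ → ℤφ) → x * ∑ n f ≡ ∑ n (λ i → x * f i)
  *-distribˡ-∑ zero x f = zeroʳ x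
  *-distribˡ-∑ (suc n) x f =
    trans (distribˡ x (f 0) (∑ n (f ∘ suc))) (cong (x * f 0 +_) (*-distribˡ-∑ n x (f ∘ suc)))

  ∑-zero : ∀ n → ∑ n (λ _ → 0#) ≡ 0#
  ∑-zero zero = refl
  ∑-zero (suc n) = trans (+-identityˡ _) (∑-zero n)

  ∑-comm : ∀ n m (h : ℕ → ℕ → ℤφ) → ∑ n (λ k → ∑ m (h k)) ≡ ∑ m (λ i → ∑ n (λ k → h k i))
  ∑-comm zero m h = sym (∑-zero m)
  ∑-comm (suc n) m h = trans (cong (∑ m (h 0) +_) (∑-comm n m (h ∘ suc)))
                             (sym (∑-distrib-+ m (h 0) (λ i → ∑ n (λ k → h (suc k) i))))

  ∑-split : ∀ a b (f : ℕ → ℤφ) → ∑ (a ℕ.+ b) f ≡ ∑ a f + ∑ b (λ i → f (a ℕ.+ i))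
  ∑-split zero b f = sym (+-identityˡ (∑ b f))
  ∑-split (suc a) b f = trans (cong (f 0 +_) (∑-split a b (f ∘ suc))) (sym (+-assoc (f 0) _ _))

  ∑-last : ∀ n (f : ℕ → ℤφ) → ∑ (suc n) f ≡ ∑ n f + f n
  ∑-last zero f = trans (+-identityʳ (f 0)) (sym (+-identityˡ (f 0)))
  ∑-last (suc n) f = trans (cong (f 0 +_) (∑-last n (f ∘ suc))) (sym (+-assoc (f 0) _ _))

  ∑-reverse : ∀ n (f : ℕ → ℤφ) → ∑ n f ≡ ∑ n (λ i → f (n ∸ suc i))
  ∑-reverse zero f = refl
  ∑-reverse (suc n) f = begin
    ∑ (suc n) f                          ≡⟨ ∑-last n f ⟩
    ∑ n f + f n                          ≡⟨ cong (_+ f n) (∑-reverse n f) ⟩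
    ∑ n (λ i → f (n ∸ suc i)) + f n      ≡⟨ +-comm _ (f n) ⟩
    ∑ (suc n) (λ i → f (suc n ∸ suc i))  ∎
    where open ≡-Reasoning

  ι-sumTo : ∀ n f → ι (sumTo n f) ≡ ∑ (suc n) (ι ∘ f)
  ι-sumTo zero f = sym (+-identityʳ (ι (f 0)))
  ι-sumTo (suc n) f = trans (cong (_+ ι (f (suc n))) (ι-sumTo n f)) (sym (∑-last (suc n) (ι ∘ f)))

  binomial-term : ℕ → ℤφ → ℤφ → ℕ → ℤφ
  binomial-term n x y k = ι (ℤ.+ (n C k)) * (x ^ k * y ^ (n ∸ k))

  binomial : ∀ n x y → (x + y) ^ n ≡ ∑ (suc n) (binomial-term n x y)
  binomial n x y = begin
    (x + y) ^ n                          ≡⟨ Binomial.theorem n x y ⟩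
    Binomial.binomialExpansion x y n     ≡⟨ sum≡∑ (suc n) term ⟩
    ∑ (suc n) term                       ≡⟨ ∑-cong′ (suc n) (λ k → ×≡ι* (n C k) (x ^ k * y ^ (n ∸ k))) ⟩
    ∑ (suc n) (binomial-term n x y)      ∎
    where
    open ≡-Reasoning
    term : ℕ → ℤφ
    term k = (n C k) ×ᵣ (x ^ k * y ^ (n ∸ k))
    sum≡∑ : ∀ m g → sum {m} (g ∘ toℕ) ≡ ∑ m g
    sum≡∑ zero g = refl
    sum≡∑ (suc m) g = cong (g 0 +_) (sum≡∑ m (g ∘ suc))
    ×≡ι* : ∀ k z → k ×ᵣ z ≡ ι (ℤ.+ k) * z
    ×≡ι* zero z = sym (zeroˡ z)
    ×≡ι* (suc k) z = begin
      z + k ×ᵣ z                ≡⟨ cong₂ _+_ (sym (*-identityˡ z)) (×≡ι* k z) ⟩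
      1# * z + ι (ℤ.+ k) * z    ≡⟨ sym (distribʳ z 1# (ι (ℤ.+ k))) ⟩
      ι (ℤ.+ suc k) * z         ∎

  binomial-term-reflect : ∀ {n k} x y → k ≤ n → binomial-term n x y (n ∸ k) ≡ binomial-term n y x k
  binomial-term-reflect {n} {k} x y k≤n = begin
    ι (ℤ.+ (n C (n ∸ k))) * (x ^ (n ∸ k) * y ^ (n ∸ (n ∸ k)))
      ≡⟨ cong₂ (λ c l → ι (ℤ.+ c) * (x ^ (n ∸ k) * y ^ l)) (sym (nCk≡nC[n∸k] k≤n)) (ℕP.m∸[m∸n]≡n k≤n) ⟩
    ι (ℤ.+ (n C k)) * (x ^ (n ∸ k) * y ^ k)
      ≡⟨ cong (ι (ℤ.+ (n C k)) *_) (*-comm (x ^ (n ∸ k)) (y ^ k)) ⟩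
    ι (ℤ.+ (n C k)) * (y ^ k * x ^ (n ∸ k))
      ∎
    where open ≡-Reasoning

  binomial-terms-paired : ∀ n i e x y → n ≡ i ℕ.+ (i ℕ.+ e) →
    binomial-term n x y i + binomial-term n x y (n ∸ i) ≡ ι (ℤ.+ (n C i)) * ((x * y) ^ i * (x ^ e + y ^ e))
  binomial-terms-paired n i e x y n≡i+i+e = begin
    binomial-term n x y i + binomial-term n x y (n ∸ i)
      ≡⟨ cong (binomial-term n x y i +_) (binomial-term-reflect x y i≤n) ⟩
    c * (x ^ i * y ^ (n ∸ i)) + c * (y ^ i * x ^ (n ∸ i))
      ≡⟨ cong (λ l → c * (x ^ i * y ^ l) + c * (y ^ i * x ^ l)) n∸i≡i+e ⟩
    c * (x ^ i * y ^ (i ℕ.+ e)) + c * (y ^ i * x ^ (i ℕ.+ e))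
      ≡⟨ cong₂ (λ s t → c * (x ^ i * s) + c * (y ^ i * t)) (^-homo-* y i e) (^-homo-* x i e) ⟩
    c * (x ^ i * (y ^ i * y ^ e)) + c * (y ^ i * (x ^ i * x ^ e))
      ≡⟨ regroup c (x ^ i) (y ^ i) (x ^ e) (y ^ e) ⟩
    c * ((x ^ i * y ^ i) * (x ^ e + y ^ e))
      ≡⟨ cong (λ t → c * (t * (x ^ e + y ^ e))) (sym (^-distrib-* x y i)) ⟩
    c * ((x * y) ^ i * (x ^ e + y ^ e))
      ∎
    where
    open ≡-Reasoning
    c = ι (ℤ.+ (n C i))
    i≤n : i ≤ n
    i≤n = subst (i ≤_) (sym n≡i+i+e) (ℕP.m≤m+n i (i ℕ.+ e))
    n∸i≡i+e : n ∸ i ≡ i ℕ.+ e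
    n∸i≡i+e = trans (cong (_∸ i) n≡i+i+e) (ℕP.m+n∸m≡n i (i ℕ.+ e))
    regroup : ∀ c a b p q → c * (a * (b * q)) + c * (b * (a * p)) ≡ c * ((a * b) * (p + q))
    regroup = solve-∀ ℤφ-ring

  binomial-odd : ∀ m x y →
    (x + y) ^ (2 ℕ.* m ℕ.+ 1)
      ≡ ∑ (suc m) (λ i → ι (ℤ.+ ((2 ℕ.* m ℕ.+ 1) C i))
                           * ((x * y) ^ i * (x ^ (2 ℕ.* (m ∸ i) ℕ.+ 1) + y ^ (2 ℕ.* (m ∸ i) ℕ.+ 1))))
  binomial-odd m x y = begin
    (x + y) ^ n                                        ≡⟨ binomial n x y ⟩
    ∑ (suc n) T                                        ≡⟨ cong (λ l → ∑ l T) (double m) ⟩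
    ∑ (suc m ℕ.+ suc m) T                              ≡⟨ ∑-split (suc m) (suc m) T ⟩
    ∑ (suc m) T + ∑ (suc m) upper                      ≡⟨ cong (∑ (suc m) T +_) (∑-reverse (suc m) upper) ⟩
    ∑ (suc m) T + ∑ (suc m) (λ i → upper (m ∸ i))      ≡⟨ sym (∑-distrib-+ (suc m) T (λ i → upper (m ∸ i))) ⟩
    ∑ (suc m) (λ i → T i + upper (m ∸ i))              ≡⟨ ∑-cong (suc m) paired ⟩
    ∑ (suc m) pair                                     ∎
    where
    open ≡-Reasoning
    n = 2 ℕ.* m ℕ.+ 1
    T = binomial-term n x y
    upper : ℕ → ℤφ
    upper i = T (suc m ℕ.+ i)
    e : ℕ → ℕ
    e i = 2 ℕ.* (m ∸ i) ℕ.+ 1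
    pair : ℕ → ℤφ
    pair i = ι (ℤ.+ (n C i)) * ((x * y) ^ i * (x ^ e i + y ^ e i))
    double : ∀ m → suc (2 ℕ.* m ℕ.+ 1) ≡ suc m ℕ.+ suc m
    double = ℕ-Solver.solve-∀
    unfold : ∀ i k → 2 ℕ.* (i ℕ.+ k) ℕ.+ 1 ≡ i ℕ.+ (i ℕ.+ (2 ℕ.* k ℕ.+ 1))
    unfold = ℕ-Solver.solve-∀
    regroup : ∀ i k → suc (i ℕ.+ k) ℕ.+ k ≡ i ℕ.+ (2 ℕ.* k ℕ.+ 1)
    regroup = ℕ-Solver.solve-∀
    n≡i+i+e : ∀ i → i ≤ m → n ≡ i ℕ.+ (i ℕ.+ e i)
    n≡i+i+e i i≤m = begin
      2 ℕ.* m ℕ.+ 1                  ≡⟨ cong (λ t → 2 ℕ.* t ℕ.+ 1) (sym (ℕP.m+[n∸m]≡n i≤m)) ⟩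
      2 ℕ.* (i ℕ.+ (m ∸ i)) ℕ.+ 1    ≡⟨ unfold i (m ∸ i) ⟩
      i ℕ.+ (i ℕ.+ e i)              ∎
    paired : ∀ i → i < suc m → T i + upper (m ∸ i) ≡ pair i
    paired i (s≤s i≤m) = begin
      T i + T (suc m ℕ.+ (m ∸ i))  ≡⟨ cong (λ k → T i + T k) reflected ⟩
      T i + T (n ∸ i)              ≡⟨ binomial-terms-paired n i (e i) x y (n≡i+i+e i i≤m) ⟩
      pair i                       ∎
      where
      reflected : suc m ℕ.+ (m ∸ i) ≡ n ∸ i
      reflected = begin
        suc m ℕ.+ (m ∸ i)                ≡⟨ cong (λ t → suc t ℕ.+ (m ∸ i)) (sym (ℕP.m+[n∸m]≡n i≤m)) ⟩
        suc (i ℕ.+ (m ∸ i)) ℕ.+ (m ∸ i)  ≡⟨ regroup i (m ∸ i) ⟩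
        i ℕ.+ e i                        ≡⟨ sym (ℕP.m+n∸m≡n i (i ℕ.+ e i)) ⟩
        i ℕ.+ (i ℕ.+ e i) ∸ i            ≡⟨ cong (_∸ i) (sym (n≡i+i+e i i≤m)) ⟩
        n ∸ i                            ∎

  signed-binomial : ℕ → ℕ → ℤφ
  signed-binomial n k = ι (neg1^ℕ k ℤ.* ℤ.+ (n C k))

  alternating-binomial : ∀ n z → ∑ (suc n) (λ k → signed-binomial n k * z ^ k) ≡ (1# + - z) ^ n
  alternating-binomial n z = sym (begin
    (1# + - z) ^ n                                  ≡⟨ cong (_^ n) (+-comm 1# (- z)) ⟩
    (- z + 1#) ^ n                                  ≡⟨ binomial n (- z) 1# ⟩
    ∑ (suc n) (binomial-term n (- z) 1#)            ≡⟨ ∑-cong′ (suc n) term ⟩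
    ∑ (suc n) (λ k → signed-binomial n k * z ^ k)   ∎)
    where
    open ≡-Reasoning
    rearrange : ∀ c s y → c * ((s * y) * 1#) ≡ (s * c) * y
    rearrange = solve-∀ ℤφ-ring
    term : ∀ k → binomial-term n (- z) 1# k ≡ signed-binomial n k * z ^ k
    term k = begin
      c * ((- z) ^ k * 1# ^ (n ∸ k))    ≡⟨ cong₂ (λ s t → c * (s * t)) (-x^n≡[-1]^n*x^n z k) (1^n≡1 (n ∸ k)) ⟩
      c * (((- 1#) ^ k * z ^ k) * 1#)   ≡⟨ rearrange c ((- 1#) ^ k) (z ^ k) ⟩
      ((- 1#) ^ k * c) * z ^ k          ≡⟨ cong (λ s → s * c * z ^ k) (sym (ι-neg1^ℕ k)) ⟩
      ι (neg1^ℕ k) * c * z ^ k          ≡⟨ cong (_* z ^ k) (sym (ι-* (neg1^ℕ k) (ℤ.+ (n C k)))) ⟩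
      signed-binomial n k * z ^ k       ∎
      where
      c = ι (ℤ.+ (n C k))

  module IntegerPowers (u u⁻¹ : ℤφ) (u*u⁻¹≡1 : u * u⁻¹ ≡ 1#) where

    pow : ℤ → ℤφ
    pow (ℤ.+ n) = u ^ n
    pow -[1+ n ] = u⁻¹ ^ suc n

    private
      x*[u*u⁻¹]≡x : ∀ x → x * (u * u⁻¹) ≡ x
      x*[u*u⁻¹]≡x x = trans (cong (x *_) u*u⁻¹≡1) (*-identityʳ x)

      cancelʳ : ∀ x → x * u * u⁻¹ ≡ x
      cancelʳ x = trans (*-assoc x u u⁻¹) (x*[u*u⁻¹]≡x x)

      cancelˡ : ∀ x → u⁻¹ * x * u ≡ x
      cancelˡ x = trans (rotate u⁻¹ x u) (x*[u*u⁻¹]≡x x)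
        where
        rotate : ∀ a x b → a * x * b ≡ x * (b * a)
        rotate = solve-∀ ℤφ-ring

    pow-suc : ∀ z → pow (z ℤ.+ 1ℤ) ≡ pow z * u
    pow-suc (ℤ.+ n) = trans (cong (u ^_) (ℕP.+-comm n 1)) (*-comm u (u ^ n))
    pow-suc -[1+ zero ] = sym (cancelˡ 1#)
    pow-suc -[1+ suc n ] = sym (cancelˡ (u⁻¹ ^ suc n))

    pow-pred : ∀ z → pow (z ℤ.+ -1ℤ) ≡ pow z * u⁻¹
    pow-pred z = begin
      pow (z ℤ.+ -1ℤ)
        ≡⟨ sym (cancelʳ (pow (z ℤ.+ -1ℤ))) ⟩
      pow (z ℤ.+ -1ℤ) * u * u⁻¹
        ≡⟨ cong (_* u⁻¹) (sym (pow-suc (z ℤ.+ -1ℤ))) ⟩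
      pow (z ℤ.+ -1ℤ ℤ.+ 1ℤ) * u⁻¹
        ≡⟨ cong (λ w → pow w * u⁻¹) (trans (ℤP.+-assoc z -1ℤ 1ℤ) (ℤP.+-identityʳ z)) ⟩
      pow z * u⁻¹
        ∎
      where open ≡-Reasoning

    pow-+ : ∀ z w → pow (z ℤ.+ w) ≡ pow z * pow w
    pow-+ z (ℤ.+ zero) = trans (cong pow (ℤP.+-identityʳ z)) (sym (*-identityʳ (pow z)))
    pow-+ z (ℤ.+ suc n) = begin
      pow (z ℤ.+ ℤ.+ suc n)
        ≡⟨ cong pow (sym (trans (ℤP.+-assoc z (ℤ.+ n) 1ℤ) (cong (λ k → z ℤ.+ ℤ.+ k) (ℕP.+-comm n 1)))) ⟩
      pow (z ℤ.+ ℤ.+ n ℤ.+ 1ℤ)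
        ≡⟨ pow-suc (z ℤ.+ ℤ.+ n) ⟩
      pow (z ℤ.+ ℤ.+ n) * u
        ≡⟨ cong (_* u) (pow-+ z (ℤ.+ n)) ⟩
      pow z * u ^ n * u
        ≡⟨ trans (*-assoc (pow z) (u ^ n) u) (cong (pow z *_) (*-comm (u ^ n) u)) ⟩
      pow z * u ^ suc n
        ∎
      where open ≡-Reasoning
    pow-+ z -[1+ zero ] = trans (pow-pred z) (cong (pow z *_) (sym (*-identityʳ u⁻¹)))
    pow-+ z -[1+ suc n ] = begin
      pow (z ℤ.+ -[1+ suc n ])
        ≡⟨ cong pow (sym (trans (ℤP.+-assoc z -[1+ n ] -1ℤ) (cong (λ w → z ℤ.+ w) (ℤP.+-comm -[1+ n ] -1ℤ)))) ⟩
      pow (z ℤ.+ -[1+ n ] ℤ.+ -1ℤ)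
        ≡⟨ pow-pred (z ℤ.+ -[1+ n ]) ⟩
      pow (z ℤ.+ -[1+ n ]) * u⁻¹
        ≡⟨ cong (_* u⁻¹) (pow-+ z -[1+ n ]) ⟩
      pow z * u⁻¹ ^ suc n * u⁻¹
        ≡⟨ trans (*-assoc (pow z) (u⁻¹ ^ suc n) u⁻¹) (cong (pow z *_) (*-comm (u⁻¹ ^ suc n) u⁻¹)) ⟩
      pow z * u⁻¹ ^ suc (suc n)
        ∎
      where open ≡-Reasoning

    pow-*ℕ : ∀ n z → pow (ℤ.+ n ℤ.* z) ≡ pow z ^ n
    pow-*ℕ zero z = cong pow (ℤP.*-zeroˡ z)
    pow-*ℕ (suc n) z = begin
      pow (ℤ.+ suc n ℤ.* z)
        ≡⟨ cong pow (trans (ℤP.*-distribʳ-+ z 1ℤ (ℤ.+ n)) (cong (ℤ._+ ℤ.+ n ℤ.* z) (ℤP.*-identityˡ z))) ⟩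
      pow (z ℤ.+ ℤ.+ n ℤ.* z)
        ≡⟨ pow-+ z (ℤ.+ n ℤ.* z) ⟩
      pow z * pow (ℤ.+ n ℤ.* z)
        ≡⟨ cong (pow z *_) (pow-*ℕ n z) ⟩
      pow z * pow z ^ n
        ∎
      where open ≡-Reasoning

    alternating-sum : ∀ n t β λ′ G → 1# + - (pow t * pow t) ≡ λ′ * pow t * G →
      ∑ (suc n) (λ k → signed-binomial n k * pow (ℤ.+ k ℤ.* (t ℤ.+ t) ℤ.+ β))
        ≡ λ′ ^ n * G ^ n * pow (β ℤ.+ ℤ.+ n ℤ.* t)
    alternating-sum n t β λ′ G factor = begin
      ∑ (suc n) (λ k → signed-binomial n k * pow (ℤ.+ k ℤ.* (t ℤ.+ t) ℤ.+ β))
        ≡⟨ ∑-cong′ (suc n) geometric ⟩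
      ∑ (suc n) (λ k → pow β * (signed-binomial n k * (pow t * pow t) ^ k))
        ≡⟨ sym (*-distribˡ-∑ (suc n) (pow β) (λ k → signed-binomial n k * (pow t * pow t) ^ k)) ⟩
      pow β * ∑ (suc n) (λ k → signed-binomial n k * (pow t * pow t) ^ k)
        ≡⟨ cong (pow β *_) (alternating-binomial n (pow t * pow t)) ⟩
      pow β * (1# + - (pow t * pow t)) ^ n
        ≡⟨ cong (λ y → pow β * y ^ n) factor ⟩
      pow β * (λ′ * pow t * G) ^ n
        ≡⟨ cong (pow β *_) (trans (^-distrib-* (λ′ * pow t) G n) (cong (_* G ^ n) (^-distrib-* λ′ (pow t) n))) ⟩
      pow β * (λ′ ^ n * pow t ^ n * G ^ n)
        ≡⟨ rearrange (pow β) (λ′ ^ n) (pow t ^ n) (G ^ n) ⟩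
      λ′ ^ n * G ^ n * (pow β * pow t ^ n)
        ≡⟨ cong (λ y → λ′ ^ n * G ^ n * y) (sym (trans (pow-+ β (ℤ.+ n ℤ.* t)) (cong (pow β *_) (pow-*ℕ n t)))) ⟩
      λ′ ^ n * G ^ n * pow (β ℤ.+ ℤ.+ n ℤ.* t)
        ∎
      where
      open ≡-Reasoning
      rearrange : ∀ p l x g → p * (l * x * g) ≡ l * g * (p * x)
      rearrange = solve-∀ ℤφ-ring
      swap : ∀ s y p → s * (y * p) ≡ p * (s * y)
      swap = solve-∀ ℤφ-ring
      geometric : ∀ k → signed-binomial n k * pow (ℤ.+ k ℤ.* (t ℤ.+ t) ℤ.+ β)
                        ≡ pow β * (signed-binomial n k * (pow t * pow t) ^ k)
      geometric k = begin
        signed-binomial n k * pow (ℤ.+ k ℤ.* (t ℤ.+ t) ℤ.+ β)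
          ≡⟨ cong (signed-binomial n k *_) (pow-+ (ℤ.+ k ℤ.* (t ℤ.+ t)) β) ⟩
        signed-binomial n k * (pow (ℤ.+ k ℤ.* (t ℤ.+ t)) * pow β)
          ≡⟨ cong (λ y → signed-binomial n k * (y * pow β)) (trans (pow-*ℕ k (t ℤ.+ t)) (cong (_^ k) (pow-+ t t))) ⟩
        signed-binomial n k * ((pow t * pow t) ^ k * pow β)
          ≡⟨ swap (signed-binomial n k) ((pow t * pow t) ^ k) (pow β) ⟩
        pow β * (signed-binomial n k * (pow t * pow t) ^ k)
          ∎

  1-x²≡-x*[x-sy] : ∀ {x y s} → x * y ≡ s → s * s ≡ 1# → 1# + - (x * x) ≡ - 1# * x * (x + - s * y)
  1-x²≡-x*[x-sy] {x} {y} {s} xy≡s ss≡1 = begin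
    1# + - (x * x)               ≡⟨ cong (λ t → t + - (x * x)) (sym (trans (cong (s *_) xy≡s) ss≡1)) ⟩
    s * (x * y) + - (x * x)      ≡⟨ expand x y s ⟩
    - 1# * x * (x + - s * y)     ∎
    where
    open ≡-Reasoning
    expand : ∀ x y s → s * (x * y) + - (x * x) ≡ - 1# * x * (x + - s * y)
    expand = solve-∀ ℤφ-ring

  1-y²≡sy*[x-sy] : ∀ {x y s} → x * y ≡ s → s * s ≡ 1# → 1# + - (y * y) ≡ s * y * (x + - s * y)
  1-y²≡sy*[x-sy] {x} {y} {s} xy≡s ss≡1 = begin
    1# + - (y * y)
      ≡⟨ cong (λ q → 1# + - q) (sym (*-identityˡ (y * y))) ⟩
    1# + - (1# * (y * y))
      ≡⟨ cong₂ (λ p q → p + - (q * (y * y))) (sym (trans (cong (s *_) xy≡s) ss≡1)) (sym ss≡1) ⟩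
    s * (x * y) + - (s * s * (y * y))
      ≡⟨ expand x y s ⟩
    s * y * (x + - s * y)
      ∎
    where
    open ≡-Reasoning
    expand : ∀ x y s → s * (x * y) + - (s * s * (y * y)) ≡ s * y * (x + - s * y)
    expand = solve-∀ ℤφ-ring

  -- ψ = 1 - φ is the conjugate of φ, and √5 = φ - ψ.
  φ ψ √5 : ℤφ
  φ = (0ℤ , 1ℤ)
  ψ = (1ℤ , -1ℤ)
  √5 = (-1ℤ , ℤ.+ 2)

  module Φ = IntegerPowers φ (- ψ) refl
  module Ψ = IntegerPowers ψ (- φ) refl

  Φ Ψ : ℤ → ℤφ
  Φ = Φ.pow
  Ψ = Ψ.pow

  binet : ℤφ → ℤ → ℤφ
  binet ε z = Φ z + ε * Ψ z

  private
    golden-step : ∀ {x} → x * x ≡ x + 1# → ∀ n → x ^ suc (suc n) ≡ x ^ suc n + x ^ n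
    golden-step {x} x²≡x+1 n = begin
      x * (x * x ^ n)         ≡⟨ sym (*-assoc x x (x ^ n)) ⟩
      x * x * x ^ n           ≡⟨ cong (_* x ^ n) x²≡x+1 ⟩
      (x + 1#) * x ^ n        ≡⟨ trans (distribʳ (x ^ n) x 1#) (cong (x * x ^ n +_) (*-identityˡ (x ^ n))) ⟩
      x * x ^ n + x ^ n       ∎
      where open ≡-Reasoning

    binet-step : ∀ ε n → binet ε (ℤ.+ suc (suc n)) ≡ binet ε (ℤ.+ suc n) + binet ε (ℤ.+ n)
    binet-step ε n = begin
      φ ^ suc (suc n) + ε * ψ ^ suc (suc n)
        ≡⟨ cong₂ (λ p q → p + ε * q) (golden-step {φ} refl n) (golden-step {ψ} refl n) ⟩
      (φ ^ suc n + φ ^ n) + ε * (ψ ^ suc n + ψ ^ n)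
        ≡⟨ regroup ε (φ ^ suc n) (φ ^ n) (ψ ^ suc n) (ψ ^ n) ⟩
      (φ ^ suc n + ε * ψ ^ suc n) + (φ ^ n + ε * ψ ^ n)
        ∎
      where
      open ≡-Reasoning
      regroup : ∀ e a b c d → (a + b) + e * (c + d) ≡ (a + e * c) + (b + e * d)
      regroup = solve-∀ ℤφ-ring

    binet-negative : ∀ ε n → binet ε -[1+ n ] ≡ (- 1#) ^ suc n * (ψ ^ suc n + ε * φ ^ suc n)
    binet-negative ε n = begin
      (- ψ) ^ suc n + ε * (- φ) ^ suc n
        ≡⟨ cong₂ (λ p q → p + ε * q) (-x^n≡[-1]^n*x^n ψ (suc n)) (-x^n≡[-1]^n*x^n φ (suc n)) ⟩
      s * ψ ^ suc n + ε * (s * φ ^ suc n)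
        ≡⟨ factor s ε (ψ ^ suc n) (φ ^ suc n) ⟩
      s * (ψ ^ suc n + ε * φ ^ suc n)
        ∎
      where
      open ≡-Reasoning
      s = (- 1#) ^ suc n
      factor : ∀ s e a b → s * a + e * (s * b) ≡ s * (a + e * b)
      factor = solve-∀ ℤφ-ring

  binet-F : ∀ z → binet (- 1#) z ≡ √5 * ι (F z)
  binet-F (ℤ.+ n) = natural n
    where
    natural : ∀ n → binet (- 1#) (ℤ.+ n) ≡ √5 * ι (ℤ.+ fibℕ n)
    natural zero = refl
    natural (suc zero) = refl
    natural (suc (suc n)) = begin
      binet (- 1#) (ℤ.+ suc (suc n))
        ≡⟨ binet-step (- 1#) n ⟩
      binet (- 1#) (ℤ.+ suc n) + binet (- 1#) (ℤ.+ n)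
        ≡⟨ cong₂ _+_ (natural (suc n)) (natural n) ⟩
      √5 * ι (ℤ.+ fibℕ (suc n)) + √5 * ι (ℤ.+ fibℕ n)
        ≡⟨ sym (distribˡ √5 (ι (ℤ.+ fibℕ (suc n))) (ι (ℤ.+ fibℕ n))) ⟩
      √5 * ι (ℤ.+ fibℕ (suc (suc n)))
        ∎
      where open ≡-Reasoning
  binet-F -[1+ n ] = begin
    binet (- 1#) -[1+ n ]
      ≡⟨ binet-negative (- 1#) n ⟩
    (- 1#) ^ suc n * (ψ ^ suc n + - 1# * φ ^ suc n)
      ≡⟨ flip ((- 1#) ^ n) (φ ^ suc n) (ψ ^ suc n) ⟩
    (- 1#) ^ n * binet (- 1#) (ℤ.+ suc n)
      ≡⟨ cong₂ _*_ (sym (ι-neg1^ℕ n)) (binet-F (ℤ.+ suc n)) ⟩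
    ι (neg1^ℕ n) * (√5 * ι (ℤ.+ fibℕ (suc n)))
      ≡⟨ swap (ι (neg1^ℕ n)) √5 (ι (ℤ.+ fibℕ (suc n))) ⟩
    √5 * (ι (neg1^ℕ n) * ι (ℤ.+ fibℕ (suc n)))
      ≡⟨ cong (√5 *_) (sym (ι-* (neg1^ℕ n) (ℤ.+ fibℕ (suc n)))) ⟩
    √5 * ι (neg1^ℕ n ℤ.* ℤ.+ fibℕ (suc n))
      ∎
    where
    open ≡-Reasoning
    flip : ∀ s a b → - 1# * s * (b + - 1# * a) ≡ s * (a + - 1# * b)
    flip = solve-∀ ℤφ-ring
    swap : ∀ s r f → s * (r * f) ≡ r * (s * f)
    swap = solve-∀ ℤφ-ring

  binet-L : ∀ z → binet 1# z ≡ ι (L z)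
  binet-L (ℤ.+ n) = natural n
    where
    natural : ∀ n → binet 1# (ℤ.+ n) ≡ ι (ℤ.+ lucℕ n)
    natural zero = refl
    natural (suc zero) = refl
    natural (suc (suc n)) = trans (binet-step 1# n) (cong₂ _+_ (natural (suc n)) (natural n))
  binet-L -[1+ n ] = begin
    binet 1# -[1+ n ]
      ≡⟨ binet-negative 1# n ⟩
    (- 1#) ^ suc n * (ψ ^ suc n + 1# * φ ^ suc n)
      ≡⟨ cong ((- 1#) ^ suc n *_) (flip (φ ^ suc n) (ψ ^ suc n)) ⟩
    (- 1#) ^ suc n * binet 1# (ℤ.+ suc n)
      ≡⟨ cong₂ _*_ (sym (ι-neg1^ℕ (suc n))) (binet-L (ℤ.+ suc n)) ⟩
    ι (neg1^ℕ (suc n)) * ι (ℤ.+ lucℕ (suc n))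
      ≡⟨ sym (ι-* (neg1^ℕ (suc n)) (ℤ.+ lucℕ (suc n))) ⟩
    ι (neg1^ℕ (suc n) ℤ.* ℤ.+ lucℕ (suc n))
      ∎
    where
    open ≡-Reasoning
    flip : ∀ a b → b + 1# * a ≡ a + 1# * b
    flip = solve-∀ ℤφ-ring

  σ : ℤ → ℤφ
  σ z = ι (neg1^ z)

  private
    neg1^ℕ-mod2 : ∀ k → neg1^ℕ k ≡ neg1^ℕ (k % 2)
    neg1^ℕ-mod2 zero = refl
    neg1^ℕ-mod2 (suc zero) = refl
    neg1^ℕ-mod2 (suc (suc k)) = begin
      ℤ.- ℤ.- neg1^ℕ k           ≡⟨ ℤP.neg-involutive (neg1^ℕ k) ⟩
      neg1^ℕ k                   ≡⟨ neg1^ℕ-mod2 k ⟩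
      neg1^ℕ (k % 2)             ≡⟨ cong neg1^ℕ (sym ([m+n]%n≡m%n k 2)) ⟩
      neg1^ℕ ((k ℕ.+ 2) % 2)     ≡⟨ cong (λ l → neg1^ℕ (l % 2)) (ℕP.+-comm k 2) ⟩
      neg1^ℕ (suc (suc k) % 2)   ∎
      where open ≡-Reasoning

    ¬2∣⇒%2≡1 : ∀ k → ¬ 2 ∣ k → k % 2 ≡ 1
    ¬2∣⇒%2≡1 k ¬2∣k with k % 2 in k%2≡r | m%n<n k 2
    ... | 0 | _ = ⊥-elim (¬2∣k (m%n≡0⇒n∣m k 2 k%2≡r))
    ... | 1 | _ = refl
    ... | suc (suc _) | s≤s (s≤s ())

  Φ*Ψ≡σ : ∀ z → Φ z * Ψ z ≡ σ z
  Φ*Ψ≡σ (ℤ.+ n) =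
    trans (sym (^-distrib-* φ ψ n)) (trans (sym (ι-neg1^ℕ n)) (cong ι (neg1^ℕ-mod2 n)))
  Φ*Ψ≡σ -[1+ n ] =
    trans (sym (^-distrib-* (- ψ) (- φ) (suc n))) (trans (sym (ι-neg1^ℕ (suc n))) (cong ι (neg1^ℕ-mod2 (suc n))))

  σ-+ : ∀ z w → σ (z ℤ.+ w) ≡ σ z * σ w
  σ-+ z w = begin
    σ (z ℤ.+ w)                         ≡⟨ sym (Φ*Ψ≡σ (z ℤ.+ w)) ⟩
    Φ (z ℤ.+ w) * Ψ (z ℤ.+ w)           ≡⟨ cong₂ _*_ (Φ.pow-+ z w) (Ψ.pow-+ z w) ⟩
    (Φ z * Φ w) * (Ψ z * Ψ w)           ≡⟨ shuffle (Φ z) (Φ w) (Ψ z) (Ψ w) ⟩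
    (Φ z * Ψ z) * (Φ w * Ψ w)           ≡⟨ cong₂ _*_ (Φ*Ψ≡σ z) (Φ*Ψ≡σ w) ⟩
    σ z * σ w                           ∎
    where
    open ≡-Reasoning
    shuffle : ∀ a b c d → (a * b) * (c * d) ≡ (a * c) * (b * d)
    shuffle = solve-∀ ℤφ-ring

  σ-*ℕ : ∀ k z → σ (ℤ.+ k ℤ.* z) ≡ σ z ^ k
  σ-*ℕ k z = begin
    σ (ℤ.+ k ℤ.* z)                      ≡⟨ sym (Φ*Ψ≡σ (ℤ.+ k ℤ.* z)) ⟩
    Φ (ℤ.+ k ℤ.* z) * Ψ (ℤ.+ k ℤ.* z)    ≡⟨ cong₂ _*_ (Φ.pow-*ℕ k z) (Ψ.pow-*ℕ k z) ⟩
    Φ z ^ k * Ψ z ^ k                    ≡⟨ sym (^-distrib-* (Φ z) (Ψ z) k) ⟩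
    (Φ z * Ψ z) ^ k                      ≡⟨ cong (_^ k) (Φ*Ψ≡σ z) ⟩
    σ z ^ k                              ∎
    where open ≡-Reasoning

  σ*σ≡1 : ∀ z → σ z * σ z ≡ 1#
  σ*σ≡1 z = begin
    σ z * σ z                  ≡⟨ cong₂ _*_ (ι-neg1^ℕ r) (ι-neg1^ℕ r) ⟩
    (- 1#) ^ r * (- 1#) ^ r    ≡⟨ sym (^-distrib-* (- 1#) (- 1#) r) ⟩
    1# ^ r                     ≡⟨ 1^n≡1 r ⟩
    1#                         ∎
    where
    open ≡-Reasoning
    r = ℤ.∣ z ∣ % 2

  σ-odd : ∀ z → ¬ 2 ∣ ℤ.∣ z ∣ → σ z ≡ - 1#
  σ-odd z ¬2∣z = cong (ι ∘ neg1^ℕ) (¬2∣⇒%2≡1 ℤ.∣ z ∣ ¬2∣z)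

  σ-even : ∀ z → 2 ∣ ℤ.∣ z ∣ → σ z ≡ 1#
  σ-even z 2∣z = cong (ι ∘ neg1^ℕ) (n∣m⇒m%n≡0 ℤ.∣ z ∣ 2 2∣z)

  2∣n⇒n≡2*[n/2] : ∀ n → 2 ∣ n → n ≡ 2 ℕ.* (n / 2)
  2∣n⇒n≡2*[n/2] n 2∣n = begin
    n                      ≡⟨ m≡m%n+[m/n]*n n 2 ⟩
    n % 2 ℕ.+ n / 2 ℕ.* 2  ≡⟨ cong (ℕ._+ n / 2 ℕ.* 2) (n∣m⇒m%n≡0 n 2 2∣n) ⟩
    n / 2 ℕ.* 2            ≡⟨ ℕP.*-comm (n / 2) 2 ⟩
    2 ℕ.* (n / 2)          ∎
    where open ≡-Reasoning

  ¬2∣n⇒n≡2*[n/2]+1 : ∀ n → ¬ 2 ∣ n → n ≡ 2 ℕ.* (n / 2) ℕ.+ 1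
  ¬2∣n⇒n≡2*[n/2]+1 n ¬2∣n = begin
    n                      ≡⟨ m≡m%n+[m/n]*n n 2 ⟩
    n % 2 ℕ.+ n / 2 ℕ.* 2  ≡⟨ cong (ℕ._+ n / 2 ℕ.* 2) (¬2∣⇒%2≡1 n ¬2∣n) ⟩
    1 ℕ.+ n / 2 ℕ.* 2      ≡⟨ ℕP.+-comm 1 (n / 2 ℕ.* 2) ⟩
    n / 2 ℕ.* 2 ℕ.+ 1      ≡⟨ cong (ℕ._+ 1) (ℕP.*-comm (n / 2) 2) ⟩
    2 ℕ.* (n / 2) ℕ.+ 1    ∎
    where open ≡-Reasoning

  record BinetForm (ε κ : ℤφ) (G : ℤ → ℤ) : Set where
    constructor binet≡
    field
      binet≡κ*G : ∀ z → binet ε z ≡ κ * ι (G z)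

  open BinetForm

  BinetForm-cong : ∀ {ε ε′ κ G} → ε ≡ ε′ → BinetForm ε′ κ G → BinetForm ε κ G
  BinetForm-cong refl form = form

  BinetForm-F : BinetForm (- 1#) √5 F
  BinetForm-F = binet≡ binet-F

  BinetForm-L : BinetForm 1# 1# L
  BinetForm-L = binet≡ (λ z → trans (binet-L z) (sym (*-identityˡ (ι (L z)))))

  [-1]^even : ∀ h → (- 1#) ^ (2 ℕ.* h) ≡ 1#
  [-1]^even h = trans (sym (^-assocʳ (- 1#) 2 h)) (1^n≡1 h)

  [-1]^odd : ∀ h → (- 1#) ^ (2 ℕ.* h ℕ.+ 1) ≡ - 1#
  [-1]^odd = x²≡1⇒x^odd≡x refl

  √5^even : ∀ h → √5 ^ (2 ℕ.* h) ≡ ι ((ℤ.+ 5) ℤ.^ h)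
  √5^even h = trans (sym (^-assocʳ √5 2 h)) (sym (ι-^ (ℤ.+ 5) h))

  √5^odd : ∀ h → √5 ^ (2 ℕ.* h ℕ.+ 1) ≡ ι ((ℤ.+ 5) ℤ.^ h) * √5
  √5^odd h = trans (^-homo-* √5 (2 ℕ.* h) 1) (cong₂ _*_ (√5^even h) (*-identityʳ √5))

  ι-alternating-sum : ∀ n (g : ℕ → ℤ) →
    ι (sumTo n (λ k → neg1^ℕ k ℤ.* ℤ.+ (n C k) ℤ.* g k)) ≡ ∑ (suc n) (λ k → signed-binomial n k * ι (g k))
  ι-alternating-sum n g = begin
    ι (sumTo n term)
      ≡⟨ ι-sumTo n term ⟩
    ∑ (suc n) (ι ∘ term)
      ≡⟨ ∑-cong′ (suc n) (λ k → ι-* (neg1^ℕ k ℤ.* ℤ.+ (n C k)) (g k)) ⟩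
    ∑ (suc n) (λ k → signed-binomial n k * ι (g k))
      ∎
    where
    open ≡-Reasoning
    term : ℕ → ℤ
    term k = neg1^ℕ k ℤ.* ℤ.+ (n C k) ℤ.* g k

  √5*ι-injective : ∀ {a b} → √5 * ι a ≡ √5 * ι b → a ≡ b
  √5*ι-injective {a} {b} eq = ℤP.neg-injective (begin
    ℤ.- a                   ≡⟨ constant-part a ⟩
    proj₁ (√5 * ι a)        ≡⟨ cong proj₁ eq ⟩
    proj₁ (√5 * ι b)        ≡⟨ sym (constant-part b) ⟩
    ℤ.- b                   ∎)
    where
    open ≡-Reasoning
    constant-part : ∀ a → ℤ.- a ≡ -1ℤ ℤ.* a ℤ.+ ℤ.+ 2 ℤ.* 0ℤ
    constant-part = ℤ-Solver.solve-∀

  c : ℕ → ℕ → ℤ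
  c m i = ℤ.+ (2 ℕ.* m ℕ.+ 1) ℤ.- ℤ.+ (2 ℕ.* i)

  c≡2[m∸i]+1 : ∀ {m i} → i ≤ m → c m i ≡ ℤ.+ (2 ℕ.* (m ∸ i) ℕ.+ 1)
  c≡2[m∸i]+1 {m} {i} i≤m = begin
    c m i                                   ≡⟨ ℤP.m-n≡m⊖n (2 ℕ.* m ℕ.+ 1) (2 ℕ.* i) ⟩
    (2 ℕ.* m ℕ.+ 1) ℤ.⊖ (2 ℕ.* i)           ≡⟨ ℤP.⊖-≥ (ℕP.≤-trans 2i≤2m (ℕP.m≤m+n (2 ℕ.* m) 1)) ⟩
    ℤ.+ (2 ℕ.* m ℕ.+ 1 ∸ 2 ℕ.* i)           ≡⟨ cong ℤ.+_ (ℕP.+-∸-comm 1 2i≤2m) ⟩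
    ℤ.+ (2 ℕ.* m ∸ 2 ℕ.* i ℕ.+ 1)           ≡⟨ cong (λ k → ℤ.+ (k ℕ.+ 1)) (sym (ℕP.*-distribˡ-∸ 2 m i)) ⟩
    ℤ.+ (2 ℕ.* (m ∸ i) ℕ.+ 1)               ∎
    where
    open ≡-Reasoning
    2i≤2m : 2 ℕ.* i ≤ 2 ℕ.* m
    2i≤2m = ℕP.*-monoʳ-≤ 2 i≤m

  σ-c* : ∀ {m i} → i ≤ m → ∀ z → σ (c m i ℤ.* z) ≡ σ z
  σ-c* {m} {i} i≤m z = begin
    σ (c m i ℤ.* z)                            ≡⟨ cong (λ w → σ (w ℤ.* z)) (c≡2[m∸i]+1 i≤m) ⟩
    σ (ℤ.+ (2 ℕ.* (m ∸ i) ℕ.+ 1) ℤ.* z)        ≡⟨ σ-*ℕ (2 ℕ.* (m ∸ i) ℕ.+ 1) z ⟩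
    σ z ^ (2 ℕ.* (m ∸ i) ℕ.+ 1)                ≡⟨ x²≡1⇒x^odd≡x (σ*σ≡1 z) (m ∸ i) ⟩
    σ z                                        ∎
    where open ≡-Reasoning

  binet-odd-power : ∀ m δ → δ * δ ≡ 1# → ∀ z →
    binet δ z ^ (2 ℕ.* m ℕ.+ 1)
      ≡ ∑ (suc m) (λ i → ι (ℤ.+ ((2 ℕ.* m ℕ.+ 1) C i)) * ((δ * σ z) ^ i * binet δ (c m i ℤ.* z)))
  binet-odd-power m δ δ²≡1 z = trans (binomial-odd m (Φ z) (δ * Ψ z)) (∑-cong (suc m) term)
    where
    swap : ∀ a d b → a * (d * b) ≡ d * (a * b)
    swap = solve-∀ ℤφ-ring
    term : ∀ i → i < suc m →
      ι (ℤ.+ ((2 ℕ.* m ℕ.+ 1) C i))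
        * ((Φ z * (δ * Ψ z)) ^ i * (Φ z ^ (2 ℕ.* (m ∸ i) ℕ.+ 1) + (δ * Ψ z) ^ (2 ℕ.* (m ∸ i) ℕ.+ 1)))
        ≡ ι (ℤ.+ ((2 ℕ.* m ℕ.+ 1) C i)) * ((δ * σ z) ^ i * binet δ (c m i ℤ.* z))
    term i (s≤s i≤m) = cong₂ (λ p q → ι (ℤ.+ ((2 ℕ.* m ℕ.+ 1) C i)) * (p ^ i * q)) product powers
      where
      e = 2 ℕ.* (m ∸ i) ℕ.+ 1
      product : Φ z * (δ * Ψ z) ≡ δ * σ z
      product = trans (swap (Φ z) δ (Ψ z)) (cong (δ *_) (Φ*Ψ≡σ z))
      powers : Φ z ^ e + (δ * Ψ z) ^ e ≡ binet δ (c m i ℤ.* z)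
      powers = begin
        Φ z ^ e + (δ * Ψ z) ^ e
          ≡⟨ cong (Φ z ^ e +_) (^-distrib-* δ (Ψ z) e) ⟩
        Φ z ^ e + δ ^ e * Ψ z ^ e
          ≡⟨ cong₂ (λ p q → p + q * Ψ z ^ e) (sym (Φ.pow-*ℕ e z)) (x²≡1⇒x^odd≡x δ²≡1 (m ∸ i)) ⟩
        Φ (ℤ.+ e ℤ.* z) + δ * Ψ z ^ e
          ≡⟨ cong (λ p → Φ (ℤ.+ e ℤ.* z) + δ * p) (sym (Ψ.pow-*ℕ e z)) ⟩
        binet δ (ℤ.+ e ℤ.* z)
          ≡⟨ cong (λ w → binet δ (w ℤ.* z)) (sym (c≡2[m∸i]+1 i≤m)) ⟩
        binet δ (c m i ℤ.* z)
          ∎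
        where open ≡-Reasoning

  module AlternatingSums (n : ℕ) (a b : ℤ) where

    x : ℕ → ℤ
    x k = ℤ.+ k ℤ.* (a ℤ.+ a) ℤ.+ b

    N : ℤ
    N = a ℤ.* ℤ.+ n ℤ.+ b

    ε : ℤφ
    ε = σ a

    private
      scale-x : ∀ q k → q ℤ.* x k ≡ ℤ.+ k ℤ.* (q ℤ.* a ℤ.+ q ℤ.* a) ℤ.+ q ℤ.* b
      scale-x q k = identity q (ℤ.+ k) a b
        where
        identity : ∀ q k a b → q ℤ.* (k ℤ.* (a ℤ.+ a) ℤ.+ b) ≡ k ℤ.* (q ℤ.* a ℤ.+ q ℤ.* a) ℤ.+ q ℤ.* b
        identity = ℤ-Solver.solve-∀

      scale-N : ∀ q → q ℤ.* b ℤ.+ ℤ.+ n ℤ.* (q ℤ.* a) ≡ q ℤ.* N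
      scale-N q = identity q (ℤ.+ n) a b
        where
        identity : ∀ q n a b → q ℤ.* b ℤ.+ n ℤ.* (q ℤ.* a) ≡ q ℤ.* (a ℤ.* n ℤ.+ b)
        identity = ℤ-Solver.solve-∀

    σ-x : ∀ k → σ (x k) ≡ σ b
    σ-x k = begin
      σ (ℤ.+ k ℤ.* (a ℤ.+ a) ℤ.+ b)
        ≡⟨ σ-+ (ℤ.+ k ℤ.* (a ℤ.+ a)) b ⟩
      σ (ℤ.+ k ℤ.* (a ℤ.+ a)) * σ b
        ≡⟨ cong (_* σ b) (trans (σ-*ℕ k (a ℤ.+ a)) (cong (_^ k) (σ-+ a a))) ⟩
      (σ a * σ a) ^ k * σ b
        ≡⟨ cong (λ s → s ^ k * σ b) (σ*σ≡1 a) ⟩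
      1# ^ k * σ b
        ≡⟨ trans (cong (_* σ b) (1^n≡1 k)) (*-identityˡ (σ b)) ⟩
      σ b
        ∎
      where open ≡-Reasoning

    alternating-binet : ∀ q δ → σ (q ℤ.* a) ≡ ε →
      ∑ (suc n) (λ k → signed-binomial n k * binet δ (q ℤ.* x k))
        ≡ (- 1#) ^ n * (binet (- ε) (q ℤ.* a) ^ n * binet (δ * (- ε) ^ n) (q ℤ.* N))
    alternating-binet q δ σt≡ε = begin
      ∑ (suc n) (λ k → signed-binomial n k * binet δ (q ℤ.* x k))
        ≡⟨ ∑-cong′ (suc n) (λ k → split (signed-binomial n k) δ (Φ (q ℤ.* x k)) (Ψ (q ℤ.* x k))) ⟩
      ∑ (suc n) (λ k → sΦ k + δ * sΨ k)
        ≡⟨ ∑-distrib-+ (suc n) sΦ (λ k → δ * sΨ k) ⟩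
      ∑ (suc n) sΦ + ∑ (suc n) (λ k → δ * sΨ k)
        ≡⟨ cong (∑ (suc n) sΦ +_) (sym (*-distribˡ-∑ (suc n) δ sΨ)) ⟩
      ∑ (suc n) sΦ + δ * ∑ (suc n) sΨ
        ≡⟨ cong₂ (λ p r → p + δ * r) alternating-Φ alternating-Ψ ⟩
      (- 1#) ^ n * G ^ n * Φ (q ℤ.* N) + δ * (ε ^ n * G ^ n * Ψ (q ℤ.* N))
        ≡⟨ cong (λ e → (- 1#) ^ n * G ^ n * Φ (q ℤ.* N) + δ * (e * G ^ n * Ψ (q ℤ.* N))) ε^n≡[-1]^n*[-ε]^n ⟩
      (- 1#) ^ n * G ^ n * Φ (q ℤ.* N) + δ * ((- 1#) ^ n * (- ε) ^ n * G ^ n * Ψ (q ℤ.* N))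
        ≡⟨ collect ((- 1#) ^ n) (G ^ n) (Φ (q ℤ.* N)) (Ψ (q ℤ.* N)) δ ((- ε) ^ n) ⟩
      (- 1#) ^ n * (G ^ n * binet (δ * (- ε) ^ n) (q ℤ.* N))
        ∎
      where
      open ≡-Reasoning
      t = q ℤ.* a
      G = binet (- ε) t
      sΦ sΨ : ℕ → ℤφ
      sΦ k = signed-binomial n k * Φ (q ℤ.* x k)
      sΨ k = signed-binomial n k * Ψ (q ℤ.* x k)
      ΦΨ≡ε : Φ t * Ψ t ≡ ε
      ΦΨ≡ε = trans (Φ*Ψ≡σ t) σt≡ε
      split : ∀ s δ f p → s * (f + δ * p) ≡ s * f + δ * (s * p)
      split = solve-∀ ℤφ-ring
      ε^n≡[-1]^n*[-ε]^n : ε ^ n ≡ (- 1#) ^ n * (- ε) ^ n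
      ε^n≡[-1]^n*[-ε]^n = trans (cong (_^ n) (double-negation ε)) (^-distrib-* (- 1#) (- ε) n)
        where
        double-negation : ∀ e → e ≡ - 1# * - e
        double-negation = solve-∀ ℤφ-ring
      collect : ∀ s g f p δ e → s * g * f + δ * (s * e * g * p) ≡ s * (g * (f + δ * e * p))
      collect = solve-∀ ℤφ-ring
      alternating-Φ : ∑ (suc n) sΦ ≡ (- 1#) ^ n * G ^ n * Φ (q ℤ.* N)
      alternating-Φ = begin
        ∑ (suc n) sΦ
          ≡⟨ ∑-cong′ (suc n) (λ k → cong (λ w → signed-binomial n k * Φ w) (scale-x q k)) ⟩
        ∑ (suc n) (λ k → signed-binomial n k * Φ (ℤ.+ k ℤ.* (t ℤ.+ t) ℤ.+ q ℤ.* b))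
          ≡⟨ Φ.alternating-sum n t (q ℤ.* b) (- 1#) G (1-x²≡-x*[x-sy] {Φ t} {Ψ t} ΦΨ≡ε (σ*σ≡1 a)) ⟩
        (- 1#) ^ n * G ^ n * Φ (q ℤ.* b ℤ.+ ℤ.+ n ℤ.* t)
          ≡⟨ cong (λ w → (- 1#) ^ n * G ^ n * Φ w) (scale-N q) ⟩
        (- 1#) ^ n * G ^ n * Φ (q ℤ.* N)
          ∎
      alternating-Ψ : ∑ (suc n) sΨ ≡ ε ^ n * G ^ n * Ψ (q ℤ.* N)
      alternating-Ψ = begin
        ∑ (suc n) sΨ
          ≡⟨ ∑-cong′ (suc n) (λ k → cong (λ w → signed-binomial n k * Ψ w) (scale-x q k)) ⟩
        ∑ (suc n) (λ k → signed-binomial n k * Ψ (ℤ.+ k ℤ.* (t ℤ.+ t) ℤ.+ q ℤ.* b))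
          ≡⟨ Ψ.alternating-sum n t (q ℤ.* b) ε G (1-y²≡sy*[x-sy] {Φ t} {Ψ t} ΦΨ≡ε (σ*σ≡1 a)) ⟩
        ε ^ n * G ^ n * Ψ (q ℤ.* b ℤ.+ ℤ.+ n ℤ.* t)
          ≡⟨ cong (λ w → ε ^ n * G ^ n * Ψ w) (scale-N q) ⟩
        ε ^ n * G ^ n * Ψ (q ℤ.* N)
          ∎

    alternating-binet-power : ∀ m δ → δ * δ ≡ 1# →
      ∑ (suc n) (λ k → signed-binomial n k * binet δ (x k) ^ (2 ℕ.* m ℕ.+ 1))
        ≡ (- 1#) ^ n * ∑ (suc m) (λ i → ι (ℤ.+ ((2 ℕ.* m ℕ.+ 1) C i))
                                          * ((δ * σ b) ^ i * (binet (- ε) (c m i ℤ.* a) ^ n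
                                                               * binet (δ * (- ε) ^ n) (c m i ℤ.* N))))
    alternating-binet-power m δ δ²≡1 = begin
      ∑ (suc n) (λ k → signed-binomial n k * binet δ (x k) ^ (2 ℕ.* m ℕ.+ 1))
        ≡⟨ ∑-cong′ (suc n) (λ k → cong (signed-binomial n k *_) (expand k)) ⟩
      ∑ (suc n) (λ k → signed-binomial n k * ∑ (suc m) (λ i → binom i * (sgn i * term i k)))
        ≡⟨ ∑-cong′ (suc n) (λ k → *-distribˡ-∑ (suc m) (signed-binomial n k) (λ i → binom i * (sgn i * term i k))) ⟩
      ∑ (suc n) (λ k → ∑ (suc m) (λ i → signed-binomial n k * (binom i * (sgn i * term i k))))
        ≡⟨ ∑-comm (suc n) (suc m) (λ k i → signed-binomial n k * (binom i * (sgn i * term i k))) ⟩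
      ∑ (suc m) (λ i → ∑ (suc n) (λ k → signed-binomial n k * (binom i * (sgn i * term i k))))
        ≡⟨ ∑-cong′ (suc m) factor-out ⟩
      ∑ (suc m) (λ i → binom i * (sgn i * ∑ (suc n) (λ k → signed-binomial n k * term i k)))
        ≡⟨ ∑-cong (suc m) evaluate ⟩
      ∑ (suc m) (λ i → binom i * (sgn i * ((- 1#) ^ n * value i)))
        ≡⟨ ∑-cong′ (suc m) (λ i → swap (binom i) (sgn i) ((- 1#) ^ n) (value i)) ⟩
      ∑ (suc m) (λ i → (- 1#) ^ n * (binom i * (sgn i * value i)))
        ≡⟨ sym (*-distribˡ-∑ (suc m) ((- 1#) ^ n) (λ i → binom i * (sgn i * value i))) ⟩
      (- 1#) ^ n * ∑ (suc m) (λ i → binom i * (sgn i * value i))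
        ∎
      where
      open ≡-Reasoning
      binom : ℕ → ℤφ
      binom i = ι (ℤ.+ ((2 ℕ.* m ℕ.+ 1) C i))
      sgn : ℕ → ℤφ
      sgn i = (δ * σ b) ^ i
      term : ℕ → ℕ → ℤφ
      term i k = binet δ (c m i ℤ.* x k)
      value : ℕ → ℤφ
      value i = binet (- ε) (c m i ℤ.* a) ^ n * binet (δ * (- ε) ^ n) (c m i ℤ.* N)
      evaluate : ∀ i → i < suc m → binom i * (sgn i * ∑ (suc n) (λ k → signed-binomial n k * term i k))
                                   ≡ binom i * (sgn i * ((- 1#) ^ n * value i))
      evaluate i (s≤s i≤m) = cong (λ s → binom i * (sgn i * s)) (alternating-binet (c m i) δ (σ-c* i≤m a))
      swap : ∀ c a s h → c * (a * (s * h)) ≡ s * (c * (a * h))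
      swap = solve-∀ ℤφ-ring
      expand : ∀ k → binet δ (x k) ^ (2 ℕ.* m ℕ.+ 1) ≡ ∑ (suc m) (λ i → binom i * (sgn i * term i k))
      expand k = trans (binet-odd-power m δ δ²≡1 (x k))
                       (∑-cong′ (suc m) (λ i → cong (λ s → binom i * ((δ * s) ^ i * term i k)) (σ-x k)))
      factor-out : ∀ i → ∑ (suc n) (λ k → signed-binomial n k * (binom i * (sgn i * term i k)))
                           ≡ binom i * (sgn i * ∑ (suc n) (λ k → signed-binomial n k * term i k))
      factor-out i = begin
        ∑ (suc n) (λ k → signed-binomial n k * (binom i * (sgn i * term i k)))
          ≡⟨ ∑-cong′ (suc n) (λ k → rearrange (signed-binomial n k) (binom i) (sgn i) (term i k)) ⟩
        ∑ (suc n) (λ k → binom i * (sgn i * (signed-binomial n k * term i k)))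
          ≡⟨ sym (*-distribˡ-∑ (suc n) (binom i) (λ k → sgn i * (signed-binomial n k * term i k))) ⟩
        binom i * ∑ (suc n) (λ k → sgn i * (signed-binomial n k * term i k))
          ≡⟨ cong (binom i *_) (sym (*-distribˡ-∑ (suc n) (sgn i) (λ k → signed-binomial n k * term i k))) ⟩
        binom i * (sgn i * ∑ (suc n) (λ k → signed-binomial n k * term i k))
          ∎
        where
        rearrange : ∀ s c a b → s * (c * (a * b)) ≡ c * (a * (s * b))
        rearrange = solve-∀ ℤφ-ring

  module Sums (m n : ℕ) (j r s : ℤ) where

    private
      jr js : ℤ
      jr = j ℤ.* r
      js = j ℤ.* s
      p : ℕ
      p = 2 ℕ.* m ℕ.+ 1
      arg : ℕ → ℤ
      arg k = j ℤ.* (ℤ.+ 2 ℤ.* r ℤ.* ℤ.+ k ℤ.+ s)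

    open AlternatingSums n jr js

    SF SL : ℤ
    SF = sumTo n (λ k → neg1^ℕ k ℤ.* ℤ.+ (n C k) ℤ.* F (arg k) ℤ.^ p)
    SL = sumTo n (λ k → neg1^ℕ k ℤ.* ℤ.+ (n C k) ℤ.* L (arg k) ℤ.^ p)

    summand : ℤ → (ℤ → ℤ) → (ℤ → ℤ) → ℕ → ℤ
    summand e G H i = neg1^ (ℤ.+ i ℤ.* e) ℤ.* ℤ.+ (p C i) ℤ.* G (c m i ℤ.* jr) ℤ.^ n ℤ.* H (c m i ℤ.* N)

    private
      ι-sum : ∀ (G : ℤ → ℤ) → ι (sumTo n (λ k → neg1^ℕ k ℤ.* ℤ.+ (n C k) ℤ.* G (arg k) ℤ.^ p))
                      ≡ ∑ (suc n) (λ k → signed-binomial n k * ι (G (x k)) ^ p)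
      ι-sum G = trans (ι-alternating-sum n (λ k → G (arg k) ℤ.^ p))
                      (∑-cong′ (suc n) (λ k → cong (signed-binomial n k *_) (ι-power k)))
        where
        arg≡x : ∀ j r s k → j ℤ.* (ℤ.+ 2 ℤ.* r ℤ.* k ℤ.+ s) ≡ k ℤ.* (j ℤ.* r ℤ.+ j ℤ.* r) ℤ.+ j ℤ.* s
        arg≡x = ℤ-Solver.solve-∀
        ι-power : ∀ k → ι (G (arg k) ℤ.^ p) ≡ ι (G (x k)) ^ p
        ι-power k = trans (ι-^ (G (arg k)) p) (cong (λ w → ι (G w) ^ p) (arg≡x j r s (ℤ.+ k)))

      binom : ℕ → ℤφ
      binom i = ι (ℤ.+ (p C i))

      ι-summand : ∀ e G H i →
        ι (summand e G H i) ≡ σ e ^ i * binom i * ι (G (c m i ℤ.* jr)) ^ n * ι (H (c m i ℤ.* N))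
      ι-summand e G H i = begin
        ι (sign ℤ.* coefficient ℤ.* g ℤ.^ n ℤ.* h)       ≡⟨ ι-* (sign ℤ.* coefficient ℤ.* g ℤ.^ n) h ⟩
        ι (sign ℤ.* coefficient ℤ.* g ℤ.^ n) * ι h       ≡⟨ cong (_* ι h) (ι-* (sign ℤ.* coefficient) (g ℤ.^ n)) ⟩
        ι (sign ℤ.* coefficient) * ι (g ℤ.^ n) * ι h     ≡⟨ cong (λ q → q * ι (g ℤ.^ n) * ι h) (ι-* sign coefficient) ⟩
        σ (ℤ.+ i ℤ.* e) * binom i * ι (g ℤ.^ n) * ι h    ≡⟨ cong₂ (λ q w → q * binom i * w * ι h) (σ-*ℕ i e) (ι-^ g n) ⟩
        σ e ^ i * binom i * ι g ^ n * ι h                ∎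
        where
        open ≡-Reasoning
        sign = neg1^ (ℤ.+ i ℤ.* e)
        coefficient = ℤ.+ (p C i)
        g = G (c m i ℤ.* jr)
        h = H (c m i ℤ.* N)

    √5*SF : √5 * ι ((ℤ.+ 5) ℤ.^ m ℤ.* SF) ≡ ∑ (suc n) (λ k → signed-binomial n k * binet (- 1#) (x k) ^ p)
    √5*SF = begin
      √5 * ι ((ℤ.+ 5) ℤ.^ m ℤ.* SF)
        ≡⟨ cong (√5 *_) (ι-* ((ℤ.+ 5) ℤ.^ m) SF) ⟩
      √5 * (ι ((ℤ.+ 5) ℤ.^ m) * ι SF)
        ≡⟨ trans (swap √5 (ι ((ℤ.+ 5) ℤ.^ m)) (ι SF)) (cong (_* ι SF) (sym (√5^odd m))) ⟩
      √5 ^ p * ι SF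
        ≡⟨ cong (√5 ^ p *_) (ι-sum F) ⟩
      √5 ^ p * ∑ (suc n) (λ k → signed-binomial n k * ι (F (x k)) ^ p)
        ≡⟨ *-distribˡ-∑ (suc n) (√5 ^ p) (λ k → signed-binomial n k * ι (F (x k)) ^ p) ⟩
      ∑ (suc n) (λ k → √5 ^ p * (signed-binomial n k * ι (F (x k)) ^ p))
        ≡⟨ ∑-cong′ (suc n) term ⟩
      ∑ (suc n) (λ k → signed-binomial n k * binet (- 1#) (x k) ^ p)
        ∎
      where
      open ≡-Reasoning
      swap : ∀ r q t → r * (q * t) ≡ (q * r) * t
      swap = solve-∀ ℤφ-ring
      commute : ∀ q s y → q * (s * y) ≡ s * (q * y)
      commute = solve-∀ ℤφ-ring
      term : ∀ k → √5 ^ p * (signed-binomial n k * ι (F (x k)) ^ p) ≡ signed-binomial n k * binet (- 1#) (x k) ^ p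
      term k = begin
        √5 ^ p * (signed-binomial n k * ι (F (x k)) ^ p)   ≡⟨ commute (√5 ^ p) (signed-binomial n k) (ι (F (x k)) ^ p) ⟩
        signed-binomial n k * (√5 ^ p * ι (F (x k)) ^ p)   ≡⟨ cong (signed-binomial n k *_) (sym (^-distrib-* √5 (ι (F (x k))) p)) ⟩
        signed-binomial n k * (√5 * ι (F (x k))) ^ p       ≡⟨ cong (λ y → signed-binomial n k * y ^ p) (sym (binet-F (x k))) ⟩
        signed-binomial n k * binet (- 1#) (x k) ^ p       ∎

    ι-SL : ι SL ≡ ∑ (suc n) (λ k → signed-binomial n k * binet 1# (x k) ^ p)
    ι-SL = trans (ι-sum L) (∑-cong′ (suc n) (λ k → cong (λ y → signed-binomial n k * y ^ p) (sym (binet-L (x k)))))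

    alternating-sum-evaluated : ∀ δ → δ * δ ≡ 1# → ∀ e {G H κ₁ κ₂} →
      σ e ≡ δ * σ js → BinetForm (- ε) κ₁ G → BinetForm (δ * (- ε) ^ n) κ₂ H →
      ∑ (suc n) (λ k → signed-binomial n k * binet δ (x k) ^ p)
        ≡ (- 1#) ^ n * (κ₁ ^ n * κ₂) * ι (sumTo m (summand e G H))
    alternating-sum-evaluated δ δ²≡1 e {G} {H} {κ₁} {κ₂} σe≡ G-form H-form = begin
      ∑ (suc n) (λ k → signed-binomial n k * binet δ (x k) ^ p)
        ≡⟨ alternating-binet-power m δ δ²≡1 ⟩
      (- 1#) ^ n * ∑ (suc m) (λ i → binom i * ((δ * σ js) ^ i * (binet (- ε) (t i) ^ n * binet (δ * (- ε) ^ n) (u i))))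
        ≡⟨ cong ((- 1#) ^ n *_) (∑-cong′ (suc m) term) ⟩
      (- 1#) ^ n * ∑ (suc m) (λ i → κ₁ ^ n * κ₂ * ι (summand e G H i))
        ≡⟨ cong ((- 1#) ^ n *_) (sym (*-distribˡ-∑ (suc m) (κ₁ ^ n * κ₂) (λ i → ι (summand e G H i)))) ⟩
      (- 1#) ^ n * (κ₁ ^ n * κ₂ * ∑ (suc m) (λ i → ι (summand e G H i)))
        ≡⟨ cong (λ y → (- 1#) ^ n * (κ₁ ^ n * κ₂ * y)) (sym (ι-sumTo m (summand e G H))) ⟩
      (- 1#) ^ n * (κ₁ ^ n * κ₂ * ι (sumTo m (summand e G H)))
        ≡⟨ sym (*-assoc ((- 1#) ^ n) (κ₁ ^ n * κ₂) (ι (sumTo m (summand e G H)))) ⟩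
      (- 1#) ^ n * (κ₁ ^ n * κ₂) * ι (sumTo m (summand e G H))
        ∎
      where
      open ≡-Reasoning
      t u : ℕ → ℤ
      t i = c m i ℤ.* jr
      u i = c m i ℤ.* N
      regroup : ∀ b s K g l h → b * (s * (K * g * (l * h))) ≡ K * l * (s * b * g * h)
      regroup = solve-∀ ℤφ-ring
      term : ∀ i → binom i * ((δ * σ js) ^ i * (binet (- ε) (t i) ^ n * binet (δ * (- ε) ^ n) (u i)))
                     ≡ κ₁ ^ n * κ₂ * ι (summand e G H i)
      term i = begin
        binom i * ((δ * σ js) ^ i * (binet (- ε) (t i) ^ n * binet (δ * (- ε) ^ n) (u i)))
          ≡⟨ cong₂ (λ q w → binom i * (q ^ i * w)) (sym σe≡)
                   (cong₂ (λ y z → y ^ n * z) (binet≡κ*G G-form (t i)) (binet≡κ*G H-form (u i))) ⟩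
        binom i * (σ e ^ i * ((κ₁ * ι (G (t i))) ^ n * (κ₂ * ι (H (u i)))))
          ≡⟨ cong (λ y → binom i * (σ e ^ i * (y * (κ₂ * ι (H (u i)))))) (^-distrib-* κ₁ (ι (G (t i))) n) ⟩
        binom i * (σ e ^ i * (κ₁ ^ n * ι (G (t i)) ^ n * (κ₂ * ι (H (u i)))))
          ≡⟨ regroup (binom i) (σ e ^ i) (κ₁ ^ n) (ι (G (t i)) ^ n) κ₂ (ι (H (u i))) ⟩
        κ₁ ^ n * κ₂ * (σ e ^ i * binom i * ι (G (t i)) ^ n * ι (H (u i)))
          ≡⟨ cong (κ₁ ^ n * κ₂ *_) (sym (ι-summand e G H i)) ⟩
        κ₁ ^ n * κ₂ * ι (summand e G H i)
          ∎

    -- In each case of the theorem the parities of jr and n determine ε and (-ε)^n, hence which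
    -- sequences G, H appear, the factors κ₁, κ₂ ∈ {1, √5} and the constant K.
    SF-closed-form : ∀ e {G H κ₁ κ₂} K →
      σ e ≡ - 1# * σ js → BinetForm (- ε) κ₁ G → BinetForm (- 1# * (- ε) ^ n) κ₂ H →
      (- 1#) ^ n * (κ₁ ^ n * κ₂) ≡ √5 * ι K →
      (ℤ.+ 5) ℤ.^ m ℤ.* SF ≡ K ℤ.* sumTo m (summand e G H)
    SF-closed-form e {G} {H} {κ₁} {κ₂} K σe≡ G-form H-form constant = √5*ι-injective (begin
      √5 * ι ((ℤ.+ 5) ℤ.^ m ℤ.* SF)                        ≡⟨ √5*SF ⟩
      ∑ (suc n) (λ k → signed-binomial n k * binet (- 1#) (x k) ^ p)
                                                          ≡⟨ alternating-sum-evaluated (- 1#) refl e σe≡ G-form H-form ⟩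
      (- 1#) ^ n * (κ₁ ^ n * κ₂) * ι (sumTo m S)          ≡⟨ cong (_* ι (sumTo m S)) constant ⟩
      √5 * ι K * ι (sumTo m S)                            ≡⟨ *-assoc √5 (ι K) (ι (sumTo m S)) ⟩
      √5 * (ι K * ι (sumTo m S))                          ≡⟨ cong (√5 *_) (sym (ι-* K (sumTo m S))) ⟩
      √5 * ι (K ℤ.* sumTo m S)                            ∎)
      where
      open ≡-Reasoning
      S = summand e G H

    SL-closed-form : ∀ e {G H κ₁ κ₂} K →
      σ e ≡ 1# * σ js → BinetForm (- ε) κ₁ G → BinetForm (1# * (- ε) ^ n) κ₂ H →
      (- 1#) ^ n * (κ₁ ^ n * κ₂) ≡ ι K →
      SL ≡ K ℤ.* sumTo m (summand e G H)
    SL-closed-form e {G} {H} {κ₁} {κ₂} K σe≡ G-form H-form constant = ι-injective (begin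
      ι SL                                                ≡⟨ ι-SL ⟩
      ∑ (suc n) (λ k → signed-binomial n k * binet 1# (x k) ^ p)
                                                          ≡⟨ alternating-sum-evaluated 1# refl e σe≡ G-form H-form ⟩
      (- 1#) ^ n * (κ₁ ^ n * κ₂) * ι (sumTo m S)          ≡⟨ cong (_* ι (sumTo m S)) constant ⟩
      ι K * ι (sumTo m S)                                 ≡⟨ sym (ι-* K (sumTo m S)) ⟩
      ι (K ℤ.* sumTo m S)                                 ∎)
      where
      open ≡-Reasoning
      S = summand e G H

    private
      h = n / 2

      σ-F-sign : σ (js ℤ.+ 1ℤ) ≡ - 1# * σ js
      σ-F-sign = trans (σ-+ js 1ℤ) (*-comm (σ js) (- 1#))

      σ-L-sign : σ js ≡ 1# * σ js
      σ-L-sign = sym (*-identityˡ (σ js))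

      -ε≡1 : ¬ 2 ∣ ℤ.∣ jr ∣ → - ε ≡ 1#
      -ε≡1 odd = cong -_ (σ-odd jr odd)

      [-ε]^n≡1 : ¬ 2 ∣ ℤ.∣ jr ∣ → (- ε) ^ n ≡ 1#
      [-ε]^n≡1 odd = trans (cong (_^ n) (-ε≡1 odd)) (1^n≡1 n)

      -ε≡-1 : 2 ∣ ℤ.∣ jr ∣ → - ε ≡ - 1#
      -ε≡-1 even = cong -_ (σ-even jr even)

      [-ε]^n≡[-1]^n : 2 ∣ ℤ.∣ jr ∣ → (- ε) ^ n ≡ (- 1#) ^ n
      [-ε]^n≡[-1]^n even = cong (_^ n) (-ε≡-1 even)

      [-1]^n-even : 2 ∣ n → (- 1#) ^ n ≡ 1#
      [-1]^n-even 2∣n = trans (cong ((- 1#) ^_) (2∣n⇒n≡2*[n/2] n 2∣n)) ([-1]^even h)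

      [-1]^n-odd : ¬ 2 ∣ n → (- 1#) ^ n ≡ - 1#
      [-1]^n-odd ¬2∣n = trans (cong ((- 1#) ^_) (¬2∣n⇒n≡2*[n/2]+1 n ¬2∣n)) ([-1]^odd h)

      √5^n-even : 2 ∣ n → √5 ^ n ≡ ι ((ℤ.+ 5) ℤ.^ h)
      √5^n-even 2∣n = trans (cong (√5 ^_) (2∣n⇒n≡2*[n/2] n 2∣n)) (√5^even h)

      √5^n-odd : ¬ 2 ∣ n → √5 ^ n ≡ ι ((ℤ.+ 5) ℤ.^ h) * √5
      √5^n-odd ¬2∣n = trans (cong (√5 ^_) (¬2∣n⇒n≡2*[n/2]+1 n ¬2∣n)) (√5^odd h)

      [n∸1]/2≡h : ¬ 2 ∣ n → (n ∸ 1) / 2 ≡ h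
      [n∸1]/2≡h ¬2∣n = begin
        (n ∸ 1) / 2               ≡⟨ cong (λ k → (k ∸ 1) / 2) (¬2∣n⇒n≡2*[n/2]+1 n ¬2∣n) ⟩
        (2 ℕ.* h ℕ.+ 1 ∸ 1) / 2   ≡⟨ cong (_/ 2) (trans (ℕP.m+n∸n≡m (2 ℕ.* h) 1) (ℕP.*-comm 2 h)) ⟩
        h ℕ.* 2 / 2               ≡⟨ m*n/n≡m h 2 ⟩
        h                         ∎
        where open ≡-Reasoning

      [1+n]/2≡1+h : ¬ 2 ∣ n → suc n / 2 ≡ suc h
      [1+n]/2≡1+h ¬2∣n = begin
        suc n / 2                 ≡⟨ cong (λ k → suc k / 2) (¬2∣n⇒n≡2*[n/2]+1 n ¬2∣n) ⟩
        suc (2 ℕ.* h ℕ.+ 1) / 2   ≡⟨ cong (_/ 2) (double h) ⟩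
        suc h ℕ.* 2 / 2           ≡⟨ m*n/n≡m (suc h) 2 ⟩
        suc h                     ∎
        where
        open ≡-Reasoning
        double : ∀ h → suc (2 ℕ.* h ℕ.+ 1) ≡ suc h ℕ.* 2
        double = ℕ-Solver.solve-∀

    SF-jr-odd : ¬ 2 ∣ ℤ.∣ jr ∣ → (ℤ.+ 5) ℤ.^ m ℤ.* SF ≡ neg1^ℕ n ℤ.* sumTo m (summand (js ℤ.+ 1ℤ) L F)
    SF-jr-odd odd = SF-closed-form (js ℤ.+ 1ℤ) (neg1^ℕ n) σ-F-sign
      (BinetForm-cong (-ε≡1 odd) BinetForm-L)
      (BinetForm-cong (trans (cong (- 1# *_) ([-ε]^n≡1 odd)) (*-identityʳ (- 1#))) BinetForm-F)
      (begin
        (- 1#) ^ n * (1# ^ n * √5)   ≡⟨ cong₂ (λ q w → q * (w * √5)) (sym (ι-neg1^ℕ n)) (1^n≡1 n) ⟩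
        ι (neg1^ℕ n) * (1# * √5)     ≡⟨ trans (cong (ι (neg1^ℕ n) *_) (*-identityˡ √5)) (*-comm (ι (neg1^ℕ n)) √5) ⟩
        √5 * ι (neg1^ℕ n)            ∎)
      where open ≡-Reasoning

    SF-jr-even-n-even : 2 ∣ ℤ.∣ jr ∣ → 2 ∣ n →
      (ℤ.+ 5) ℤ.^ m ℤ.* SF ≡ (ℤ.+ 5) ℤ.^ (n / 2) ℤ.* sumTo m (summand (js ℤ.+ 1ℤ) F F)
    SF-jr-even-n-even even 2∣n = SF-closed-form (js ℤ.+ 1ℤ) ((ℤ.+ 5) ℤ.^ h) σ-F-sign
      (BinetForm-cong (-ε≡-1 even) BinetForm-F)
      (BinetForm-cong (trans (cong (- 1# *_) (trans ([-ε]^n≡[-1]^n even) ([-1]^n-even 2∣n))) (*-identityʳ (- 1#)))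
                      BinetForm-F)
      (begin
        (- 1#) ^ n * (√5 ^ n * √5)      ≡⟨ cong₂ (λ q w → q * (w * √5)) ([-1]^n-even 2∣n) (√5^n-even 2∣n) ⟩
        1# * (ι ((ℤ.+ 5) ℤ.^ h) * √5)   ≡⟨ trans (*-identityˡ _) (*-comm (ι ((ℤ.+ 5) ℤ.^ h)) √5) ⟩
        √5 * ι ((ℤ.+ 5) ℤ.^ h)          ∎)
      where open ≡-Reasoning

    SF-jr-even-n-odd : 2 ∣ ℤ.∣ jr ∣ → ¬ 2 ∣ n →
      (ℤ.+ 5) ℤ.^ m ℤ.* SF ≡ ℤ.- ((ℤ.+ 5) ℤ.^ ((n ∸ 1) / 2) ℤ.* sumTo m (summand (js ℤ.+ 1ℤ) F L))
    SF-jr-even-n-odd even ¬2∣n = trans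
      (SF-closed-form (js ℤ.+ 1ℤ) (ℤ.- (ℤ.+ 5) ℤ.^ ((n ∸ 1) / 2)) σ-F-sign
        (BinetForm-cong (-ε≡-1 even) BinetForm-F)
        (BinetForm-cong (cong (- 1# *_) (trans ([-ε]^n≡[-1]^n even) ([-1]^n-odd ¬2∣n))) BinetForm-L)
        (begin
          (- 1#) ^ n * (√5 ^ n * 1#)               ≡⟨ cong₂ (λ q w → q * (w * 1#)) ([-1]^n-odd ¬2∣n) (√5^n-odd ¬2∣n) ⟩
          - 1# * (ι ((ℤ.+ 5) ℤ.^ h) * √5 * 1#)     ≡⟨ regroup (ι ((ℤ.+ 5) ℤ.^ h)) ⟩
          √5 * - ι ((ℤ.+ 5) ℤ.^ h)                 ≡⟨ cong (λ k → √5 * - ι ((ℤ.+ 5) ℤ.^ k)) (sym ([n∸1]/2≡h ¬2∣n)) ⟩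
          √5 * ι (ℤ.- (ℤ.+ 5) ℤ.^ ((n ∸ 1) / 2))   ∎))
      (sym (ℤP.neg-distribˡ-* ((ℤ.+ 5) ℤ.^ ((n ∸ 1) / 2)) (sumTo m (summand (js ℤ.+ 1ℤ) F L))))
      where
      open ≡-Reasoning
      regroup : ∀ q → - 1# * (q * √5 * 1#) ≡ √5 * - q
      regroup = solve-∀ ℤφ-ring

    SL-jr-odd : ¬ 2 ∣ ℤ.∣ jr ∣ → SL ≡ neg1^ℕ n ℤ.* sumTo m (summand js L L)
    SL-jr-odd odd = SL-closed-form js (neg1^ℕ n) σ-L-sign
      (BinetForm-cong (-ε≡1 odd) BinetForm-L)
      (BinetForm-cong (trans (cong (1# *_) ([-ε]^n≡1 odd)) (*-identityʳ 1#)) BinetForm-L)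
      (begin
        (- 1#) ^ n * (1# ^ n * 1#)   ≡⟨ cong₂ (λ q w → q * (w * 1#)) (sym (ι-neg1^ℕ n)) (1^n≡1 n) ⟩
        ι (neg1^ℕ n) * (1# * 1#)     ≡⟨ *-identityʳ (ι (neg1^ℕ n)) ⟩
        ι (neg1^ℕ n)                 ∎)
      where open ≡-Reasoning

    SL-jr-even-n-even : 2 ∣ ℤ.∣ jr ∣ → 2 ∣ n → SL ≡ (ℤ.+ 5) ℤ.^ (n / 2) ℤ.* sumTo m (summand js F L)
    SL-jr-even-n-even even 2∣n = SL-closed-form js ((ℤ.+ 5) ℤ.^ h) σ-L-sign
      (BinetForm-cong (-ε≡-1 even) BinetForm-F)
      (BinetForm-cong (trans (cong (1# *_) (trans ([-ε]^n≡[-1]^n even) ([-1]^n-even 2∣n))) (*-identityʳ 1#))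
                      BinetForm-L)
      (begin
        (- 1#) ^ n * (√5 ^ n * 1#)      ≡⟨ cong₂ (λ q w → q * (w * 1#)) ([-1]^n-even 2∣n) (√5^n-even 2∣n) ⟩
        1# * (ι ((ℤ.+ 5) ℤ.^ h) * 1#)   ≡⟨ trans (*-identityˡ _) (*-identityʳ _) ⟩
        ι ((ℤ.+ 5) ℤ.^ h)               ∎)
      where open ≡-Reasoning

    SL-jr-even-n-odd : 2 ∣ ℤ.∣ jr ∣ → ¬ 2 ∣ n →
      SL ≡ ℤ.- ((ℤ.+ 5) ℤ.^ (suc n / 2) ℤ.* sumTo m (summand js F F))
    SL-jr-even-n-odd even ¬2∣n = trans
      (SL-closed-form js (ℤ.- (ℤ.+ 5) ℤ.^ (suc n / 2)) σ-L-sign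
        (BinetForm-cong (-ε≡-1 even) BinetForm-F)
        (BinetForm-cong (trans (cong (1# *_) (trans ([-ε]^n≡[-1]^n even) ([-1]^n-odd ¬2∣n))) (*-identityˡ (- 1#)))
                        BinetForm-F)
        (begin
          (- 1#) ^ n * (√5 ^ n * √5)               ≡⟨ cong₂ (λ q w → q * (w * √5)) ([-1]^n-odd ¬2∣n) (√5^n-odd ¬2∣n) ⟩
          - 1# * (ι ((ℤ.+ 5) ℤ.^ h) * √5 * √5)     ≡⟨ regroup (ι ((ℤ.+ 5) ℤ.^ h)) ⟩
          - (ι (ℤ.+ 5) * ι ((ℤ.+ 5) ℤ.^ h))        ≡⟨ cong -_ (sym (ι-* (ℤ.+ 5) ((ℤ.+ 5) ℤ.^ h))) ⟩
          - ι ((ℤ.+ 5) ℤ.^ suc h)                  ≡⟨ cong (λ k → - ι ((ℤ.+ 5) ℤ.^ k)) (sym ([1+n]/2≡1+h ¬2∣n)) ⟩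
          ι (ℤ.- (ℤ.+ 5) ℤ.^ (suc n / 2))          ∎))
      (sym (ℤP.neg-distribˡ-* ((ℤ.+ 5) ℤ.^ (suc n / 2)) (sumTo m (summand js F F))))
      where
      open ≡-Reasoning
      regroup : ∀ q → - 1# * (q * √5 * √5) ≡ - (√5 * √5 * q)
      regroup = solve-∀ ℤφ-ring

open import Data.Integer using (+_; -_; _+_; _-_; _*_; _^_)

theorem6 : (m n : ℕ) (j r s : ℤ) →
  let c : ℕ → ℤ
      c i = + (2 ℕ.* m ℕ.+ 1) - + (2 ℕ.* i)
      jr = j * r
      N = jr * + n + j * s
      SF = sumTo n (λ k → neg1^ℕ k * + (n C k) * F (j * (+ 2 * r * + k + s)) ^ (2 ℕ.* m ℕ.+ 1))
      SL = sumTo n (λ k → neg1^ℕ k * + (n C k) * L (j * (+ 2 * r * + k + s)) ^ (2 ℕ.* m ℕ.+ 1))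
  in ((¬ (2 ∣ ℤ.∣ jr ∣) →
        (+ 5) ^ m * SF
          ≡ neg1^ℕ n * sumTo m (λ i → neg1^ (+ i * (j * s + + 1)) * + ((2 ℕ.* m ℕ.+ 1) C i)
                                       * L (c i * jr) ^ n * F (c i * N)))
    × (2 ∣ ℤ.∣ jr ∣ → 2 ∣ n →
        (+ 5) ^ m * SF
          ≡ (+ 5) ^ (n / 2) * sumTo m (λ i → neg1^ (+ i * (j * s + + 1)) * + ((2 ℕ.* m ℕ.+ 1) C i)
                                       * F (c i * jr) ^ n * F (c i * N)))
    × (2 ∣ ℤ.∣ jr ∣ → ¬ (2 ∣ n) →
        (+ 5) ^ m * SF
          ≡ - ((+ 5) ^ ((n ℕ.∸ 1) / 2) * sumTo m (λ i → neg1^ (+ i * (j * s + + 1)) * + ((2 ℕ.* m ℕ.+ 1) C i)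
                                       * F (c i * jr) ^ n * L (c i * N)))))
  × ((¬ (2 ∣ ℤ.∣ jr ∣) →
        SL ≡ neg1^ℕ n * sumTo m (λ i → neg1^ (+ i * (j * s)) * + ((2 ℕ.* m ℕ.+ 1) C i)
                                       * L (c i * jr) ^ n * L (c i * N)))
    × (2 ∣ ℤ.∣ jr ∣ → 2 ∣ n →
        SL ≡ (+ 5) ^ (n / 2) * sumTo m (λ i → neg1^ (+ i * (j * s)) * + ((2 ℕ.* m ℕ.+ 1) C i)
                                       * F (c i * jr) ^ n * L (c i * N)))
    × (2 ∣ ℤ.∣ jr ∣ → ¬ (2 ∣ n) →
        SL ≡ - ((+ 5) ^ (suc n / 2) * sumTo m (λ i → neg1^ (+ i * (j * s)) * + ((2 ℕ.* m ℕ.+ 1) C i)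
                                       * F (c i * jr) ^ n * F (c i * N)))))
theorem6 m n j r s =
  (SF-jr-odd , SF-jr-even-n-even , SF-jr-even-n-odd) , (SL-jr-odd , SL-jr-even-n-even , SL-jr-even-n-odd)
  where open Binet.Sums m n j r s
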